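{- For $n\ge1$, the expected number of lucky cars in a uniformly random weakly increasing unit Fubini ranking with $n$ competitors is \[\mathbb{E}[\mathrm{lucky}(\alpha):\alpha\in\mathrm{UFR}_n^{\uparrow}]=\frac{1}{F_{n+1}}\sum_{k=1}^n k\binom{k}{n-k},\] and moreover $\mathbb{E}[\mathrm{lucky}(\alpha):\alpha\in\mathrm{UFR}_n^{\uparrow}]\sim\frac{1}{10}\bigl((5+\sqrt5)n+\sqrt5-1\bigr)$ as $n\to\infty$.
   Context: $\mathrm{UFR}_n^{\uparrow}$ is the set of weakly increasing unit Fubini rankings with $n$ competitors: tuples $\alpha=(a_1,\ldots,a_n)\in\{1,\ldots,n\}^n$ with $a_1\le\cdots\le a_n$, $a_i=1+|\{j:a_j<a_i\}|$ for every $i$, and each value appearing at most twice. $\mathrm{lucky}(\alpha)$ is the number of lucky cars: cars $1,\ldots,n$ enter in order a one-way street with spots $1,\ldots,n$, car $i$ parks at spot $a_i$ if free, else at the first free spot after $a_i$, and is lucky if it parks at $a_i$. $F_m$ are Fibonacci numbers with $F_1=F_2=1$, $F_{m+1}=F_m+F_{m-1}$. $f\sim g$ means $f(n)/g(n)\to1$. -}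

module Defs where

open import Data.Bool using (Bool; true; false; _∧_; _∨_; not; if_then_else_)
open import Data.Nat as ℕ using (ℕ; zero; suc; _≤ᵇ_; _<ᵇ_; _≡ᵇ_)
open import Data.Nat.Combinatorics using (_C_)
open import Data.List using (List; []; _∷_; length; map; concatMap; filterᵇ; upTo)
open import Data.Bool.ListAction using (all; any)
open import Data.Nat.ListAction using (sum)
open import Data.Integer using (+_)
open import Data.Rational using (ℚ; _/_; 0ℚ; _+_; _*_; _-_; _<_; _≤_)
open import Data.Product using (_×_; _,_)
open import Data.Sum using (_⊎_)

F : ℕ → ℕ
F zero = 0
F (suc zero) = 1
F (suc (suc m)) = F (suc m) ℕ.+ F m

tuples : ℕ → ℕ → List (List ℕ)
tuples zero n = [] ∷ []
tuples (suc k) n =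
  concatMap (λ a → map (a ∷_) (tuples k n)) (map suc (upTo n))

countᵇ : (ℕ → Bool) → List ℕ → ℕ
countᵇ p xs = length (filterᵇ p xs)

weaklyIncreasing : List ℕ → Bool
weaklyIncreasing [] = true
weaklyIncreasing (x ∷ []) = true
weaklyIncreasing (x ∷ y ∷ ys) = (x ≤ᵇ y) ∧ weaklyIncreasing (y ∷ ys)

fubiniCond : List ℕ → Bool
fubiniCond α = all (λ a → a ≡ᵇ suc (countᵇ (λ b → b <ᵇ a) α)) α

atMostTwice : List ℕ → Bool
atMostTwice α = all (λ a → countᵇ (λ b → b ≡ᵇ a) α ≤ᵇ 2) α

isUFR↑ : List ℕ → Bool
isUFR↑ α = weaklyIncreasing α ∧ fubiniCond α ∧ atMostTwice α

UFR↑ : ℕ → List (List ℕ)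
UFR↑ n = filterᵇ isUFR↑ (tuples n n)

elemᵇ : ℕ → List ℕ → Bool
elemᵇ x = any (λ y → y ≡ᵇ x)

firstFree : ℕ → ℕ → List ℕ → List ℕ
firstFree zero a occ = []
firstFree (suc fuel) a occ =
  if elemᵇ a occ then firstFree fuel (suc a) occ else (a ∷ [])

-- number of lucky cars among the remaining cars, given occupied spots
-- (n = number of spots)
luckyFrom : ℕ → List ℕ → List ℕ → ℕ
luckyFrom n occ [] = 0
luckyFrom n occ (a ∷ as) =
  (if elemᵇ a occ then 0 else 1)
  ℕ.+ luckyFrom n (firstFree (suc n ℕ.∸ a) a occ Data.List.++ occ) as

lucky : List ℕ → ℕ
lucky α = luckyFrom (length α) [] α

-- Expected number of lucky cars over UFR↑_n (uniform distribution)
-- (convention 0 if the set were empty; it is nonempty for n ≥ 1)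

ratio : ℕ → ℕ → ℚ
ratio s zero = 0ℚ
ratio s (suc c) = (+ s) / suc c

expectedLucky : ℕ → ℚ
expectedLucky n = ratio (sum (map lucky (UFR↑ n))) (length (UFR↑ n))

closedForm : ℕ → ℚ
closedForm n =
  ratio (sum (map (λ k → k ℕ.* (k C (n ℕ.∸ k))) (map suc (upTo n)))) (F (suc n))

-- The real quadratic field ℚ(√5): a pair (a , b) denotes a + b√5,
-- with its (real) order.

infixl 6 _+₅_ _-₅_
infixl 7 _*₅_
infix 4 _<₅_

ℚ5 : Set
ℚ5 = ℚ × ℚ

ι : ℚ → ℚ5
ι q = q , 0ℚ

√5 : ℚ5
√5 = 0ℚ , (+ 1 / 1)

_+₅_ : ℚ5 → ℚ5 → ℚ5
(a , b) +₅ (c , d) = a + c , b + d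

_-₅_ : ℚ5 → ℚ5 → ℚ5
(a , b) -₅ (c , d) = a - c , b - d

_*₅_ : ℚ5 → ℚ5 → ℚ5
(a , b) *₅ (c , d) = a * c + (+ 5 / 1) * (b * d) , a * d + b * c

-- a + b√5 > 0 as a real number
Positive₅ : ℚ5 → Set
Positive₅ (a , b) =
     (0ℚ ≤ a × 0ℚ ≤ b × (0ℚ < a ⊎ 0ℚ < b))
  ⊎ (0ℚ < a × b < 0ℚ × (+ 5 / 1) * (b * b) < a * a)
  ⊎ (a < 0ℚ × 0ℚ < b × a * a < (+ 5 / 1) * (b * b))

_<₅_ : ℚ5 → ℚ5 → Set
x <₅ y = Positive₅ (y -₅ x)

AbsDiffLt₅ : ℚ5 → ℚ5 → ℚ5 → Set
AbsDiffLt₅ x y z = ((x -₅ y) <₅ z) × ((y -₅ x) <₅ z)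

asymp : ℕ → ℚ5
asymp n = ι (+ 1 / 10) *₅ (((ι (+ 5 / 1) +₅ √5) *₅ ι (+ n / 1)) +₅ √5 -₅ ι (+ 1 / 1))

-- f ∼ g  (for g eventually positive): f(n)/g(n) → 1, i.e.
-- ∀ ε > 0, ∃ N, ∀ n ≥ N, |f(n) - g(n)| < ε g(n)
open import Data.Product using (∃)
_∼_ : (ℕ → ℚ) → (ℕ → ℚ5) → Set
f ∼ g = ∀ (ε : ℚ) → 0ℚ < ε → ∃ λ N → ∀ n → N ℕ.≤ n →
          AbsDiffLt₅ (ι (f n)) (g n) (ι ε *₅ g n)

{-# OPTIONS --safe #-}
module Submission where

-- A weakly increasing unit Fubini ranking is a sequence of blocks of one or two
-- equal entries, the block that starts after p cars having value p + 1, so the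
-- rankings of n competitors correspond to the compositions of n into parts 1 and
-- 2: there are F (n + 1) of them, C(k, n - k) of them with k parts.  When the cars
-- park, the first car of each block finds its spot free and the second is bumped
-- to the next spot, so the lucky cars are the blocks.  This gives the closed form
-- for the total number T n of lucky cars, and 5 T n = 3 n F (n + 1) + (n + 1) F n,
-- so the expectation is the asymptotic expression with √5 replaced by
-- t = 1 + 2 F n / F (n + 1); by Cassini's identity t² = 5 ∓ 4 / F (n + 1)².
-- Inequalities in ℚ(√5) reduce to rationals: a + b√5 is positive as soon as
-- a + b r is positive at a rational r below √5 and at one above it, and t ± 1/m
-- bracket √5 for large n.

module Counting where
  open import Defs
  open import Algebra.Bundles using (CommutativeMonoid)
  open import Data.Bool using (Bool; true; false; _∧_; if_then_else_; T)
  open import Data.Bool.ListAction using (all)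
  open import Data.Bool.Properties using (T-∧; ∧-assoc; ∧-zeroʳ; ∧-commutativeMonoid)
  open import Data.Empty using (⊥-elim)
  open import Data.List using (List; []; _∷_; _++_; length; map; concatMap; filterᵇ; upTo; applyUpTo)
  open import Data.List.Properties using (map-applyUpTo; filter-++; filter-all; filter-none; length-++)
  open import Data.List.Relation.Unary.All as All using (All; []; _∷_)
  open import Data.Nat using (ℕ; zero; suc; _+_; _∸_; _≤_; _<_; z≤n; z<s; s<s; _≡ᵇ_; _<ᵇ_; _≤ᵇ_; _≟_)
  open import Data.Nat.ListAction using (sum)
  open import Data.Nat.Properties
  open import Data.Product using (_,_; proj₂)
  open import Data.Unit using (tt)
  open import Function using (Equivalence; _∘_; _∘′_)
  open import Relation.Binary.PropositionalEquality
  open import Relation.Nullary using (yes; no; ¬_)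
  open import Relation.Nullary.Decidable using (T?)
  open import Algebra.Properties.CommutativeSemigroup +-commutativeSemigroup using (interchange)
  open import Algebra.Properties.CommutativeSemigroup (CommutativeMonoid.commutativeSemigroup ∧-commutativeMonoid)
    using () renaming (interchange to ∧-interchange)

  ≡ᵇ-refl : ∀ n → (n ≡ᵇ n) ≡ true
  ≡ᵇ-refl zero    = refl
  ≡ᵇ-refl (suc n) = ≡ᵇ-refl n

  ≢⇒≡ᵇ-false : ∀ {m n} → m ≢ n → (m ≡ᵇ n) ≡ false
  ≢⇒≡ᵇ-false {m} {n} m≢n with m ≡ᵇ n in eq
  ... | true  = ⊥-elim (m≢n (≡ᵇ⇒≡ m n (subst T (sym eq) tt)))
  ... | false = refl

  <⇒≡ᵇ-false : ∀ {m n} → m < n → (m ≡ᵇ n) ≡ false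
  <⇒≡ᵇ-false m<n = ≢⇒≡ᵇ-false (<⇒≢ m<n)

  ≤⇒¬<ᵇ : ∀ {m n} → n ≤ m → ¬ T (m <ᵇ n)
  ≤⇒¬<ᵇ n≤m m<ᵇn = <⇒≱ (<ᵇ⇒< _ _ m<ᵇn) n≤m

  ≢⇒¬≡ᵇ : ∀ {m n} → m ≢ n → ¬ T (m ≡ᵇ n)
  ≢⇒¬≡ᵇ m≢n m≡ᵇn = m≢n (≡ᵇ⇒≡ _ _ m≡ᵇn)

  sumWhere : (List ℕ → Bool) → (List ℕ → ℕ) → List (List ℕ) → ℕ
  sumWhere p f []       = 0
  sumWhere p f (β ∷ βs) = (if p β then f β else 0) + sumWhere p f βs

  sum-map-filterᵇ : ∀ p f βs → sum (map f (filterᵇ p βs)) ≡ sumWhere p f βs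
  sum-map-filterᵇ p f []       = refl
  sum-map-filterᵇ p f (β ∷ βs) with p β
  ... | true  = cong (f β +_) (sum-map-filterᵇ p f βs)
  ... | false = sum-map-filterᵇ p f βs

  length-filterᵇ : ∀ p βs → length (filterᵇ p βs) ≡ sumWhere p (λ _ → 1) βs
  length-filterᵇ p []       = refl
  length-filterᵇ p (β ∷ βs) with p β
  ... | true  = cong suc (length-filterᵇ p βs)
  ... | false = length-filterᵇ p βs

  sumWhere-cong : ∀ {p q f g} βs → (∀ β → p β ≡ q β) → (∀ β → f β ≡ g β) →
                  sumWhere p f βs ≡ sumWhere q g βs
  sumWhere-cong []       p≗q f≗g = refl
  sumWhere-cong (β ∷ βs) p≗q f≗g =
    cong₂ _+_ (cong₂ (λ b x → if b then x else 0) (p≗q β) (f≗g β)) (sumWhere-cong βs p≗q f≗g)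

  sumWhere-none : ∀ f βs → sumWhere (λ _ → false) f βs ≡ 0
  sumWhere-none f []       = refl
  sumWhere-none f (β ∷ βs) = sumWhere-none f βs

  sumWhere-+ : ∀ p f g βs → sumWhere p (λ β → f β + g β) βs ≡ sumWhere p f βs + sumWhere p g βs
  sumWhere-+ p f g []       = refl
  sumWhere-+ p f g (β ∷ βs) with p β
  ... | true  = trans (cong (f β + g β +_) (sumWhere-+ p f g βs)) (interchange (f β) (g β) _ _)
  ... | false = sumWhere-+ p f g βs

  sumWhere-++ : ∀ p f βs γs → sumWhere p f (βs ++ γs) ≡ sumWhere p f βs + sumWhere p f γs
  sumWhere-++ p f []       γs = refl
  sumWhere-++ p f (β ∷ βs) γs =
    trans (cong (_ +_) (sumWhere-++ p f βs γs)) (sym (+-assoc (if p β then f β else 0) _ _))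

  sumWhere-map-∷ : ∀ p f a βs →
                   sumWhere p f (map (a ∷_) βs) ≡ sumWhere (λ β → p (a ∷ β)) (λ β → f (a ∷ β)) βs
  sumWhere-map-∷ p f a []       = refl
  sumWhere-map-∷ p f a (β ∷ βs) = cong (_ +_) (sumWhere-map-∷ p f a βs)

  sumWhere-head : ∀ j c q (g : ℕ → List ℕ → ℕ) βs →
    sumWhere (λ β → (j ≡ᵇ c) ∧ q β) (g j) βs ≡ (if j ≡ᵇ c then sumWhere q (g c) βs else 0)
  sumWhere-head j c q g βs with j ≡ᵇ c in eq
  ... | true  rewrite ≡ᵇ⇒≡ j c (subst T (sym eq) tt) = refl
  ... | false = sumWhere-none (g j) βs

  sum-applyUpTo-cong : ∀ {f g} n → (∀ j → j < n → f j ≡ g j) →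
                       sum (applyUpTo f n) ≡ sum (applyUpTo g n)
  sum-applyUpTo-cong zero    f≗g = refl
  sum-applyUpTo-cong (suc n) f≗g =
    cong₂ _+_ (f≗g 0 z<s) (sum-applyUpTo-cong n (λ j j<n → f≗g (suc j) (s<s j<n)))

  sum-applyUpTo-+ : ∀ f g n → sum (applyUpTo (λ j → f j + g j) n) ≡
                              sum (applyUpTo f n) + sum (applyUpTo g n)
  sum-applyUpTo-+ f g zero    = refl
  sum-applyUpTo-+ f g (suc n) =
    trans (cong (f 0 + g 0 +_) (sum-applyUpTo-+ (λ j → f (suc j)) (λ j → g (suc j)) n))
          (interchange (f 0) (g 0) _ _)

  sum-applyUpTo-0 : ∀ n → sum (applyUpTo (λ _ → 0) n) ≡ 0
  sum-applyUpTo-0 zero    = refl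
  sum-applyUpTo-0 (suc n) = sum-applyUpTo-0 n

  sum-applyUpTo-indicator : ∀ X {c n} → c < n → sum (applyUpTo (λ j → if j ≡ᵇ c then X else 0) n) ≡ X
  sum-applyUpTo-indicator X {zero}  {suc n} _         = trans (cong (X +_) (sum-applyUpTo-0 n)) (+-identityʳ X)
  sum-applyUpTo-indicator X {suc c} {suc n} (s<s c<n) = sum-applyUpTo-indicator X c<n

  sum-map-suc-upTo : ∀ (h : ℕ → ℕ) n →
                     sum (map h (map suc (upTo n))) ≡ sum (applyUpTo (λ j → h (suc j)) n)
  sum-map-suc-upTo h n =
    cong sum (trans (cong (map h) (map-applyUpTo (λ j → j) suc n)) (map-applyUpTo suc h n))

  sumWhere-concatMap-∷ : ∀ p f βs as →
    sumWhere p f (concatMap (λ a → map (a ∷_) βs) as) ≡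
    sum (map (λ a → sumWhere (λ β → p (a ∷ β)) (λ β → f (a ∷ β)) βs) as)
  sumWhere-concatMap-∷ p f βs []       = refl
  sumWhere-concatMap-∷ p f βs (a ∷ as) =
    trans (sumWhere-++ p f (map (a ∷_) βs) _)
          (cong₂ _+_ (sumWhere-map-∷ p f a βs) (sumWhere-concatMap-∷ p f βs as))

  sumWhere-tuples : ∀ p f k n → sumWhere p f (tuples (suc k) n) ≡
    sum (applyUpTo (λ j → sumWhere (λ β → p (suc j ∷ β)) (λ β → f (suc j ∷ β)) (tuples k n)) n)
  sumWhere-tuples p f k n =
    trans (sumWhere-concatMap-∷ p f (tuples k n) (map suc (upTo n))) (sum-map-suc-upTo _ n)

  -- Weakly increasing unit Fubini rankings as sequences of blocks

  -- blocksFrom i β: β continues a ranking whose first i cars form complete blocks;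
  -- inBlock i β: the same after one more car has opened a block of value i + 1.
  mutual
    blocksFrom : ℕ → List ℕ → Bool
    blocksFrom i []      = true
    blocksFrom i (a ∷ β) = (a ≡ᵇ suc i) ∧ inBlock i β

    inBlock : ℕ → List ℕ → Bool
    inBlock i []      = true
    inBlock i (b ∷ β) = if b ≡ᵇ suc i then blocksFrom (suc (suc i)) β else blocksFrom (suc i) (b ∷ β)

  sumWhere-blocksFrom-tuples : ∀ {i n} f k → i < n →
    sumWhere (blocksFrom i) f (tuples (suc k) n) ≡ sumWhere (inBlock i) (λ β → f (suc i ∷ β)) (tuples k n)
  sumWhere-blocksFrom-tuples {i} {n} f k i<n =
    trans (sumWhere-tuples (blocksFrom i) f k n)
    (trans (sum-applyUpTo-cong n (λ j _ →
              sumWhere-head j i (inBlock i) (λ a β → f (suc a ∷ β)) (tuples k n)))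
           (sum-applyUpTo-indicator _ i<n))

  sumWhere-inBlock-tuples : ∀ {i n} f k → suc i < n →
    sumWhere (inBlock i) f (tuples (suc k) n) ≡
    sumWhere (blocksFrom (suc (suc i))) (λ β → f (suc i ∷ β)) (tuples k n) +
    sumWhere (inBlock (suc i)) (λ β → f (suc (suc i) ∷ β)) (tuples k n)
  sumWhere-inBlock-tuples {i} {n} f k 1+i<n =
    trans (sumWhere-tuples (inBlock i) f k n)
    (trans (sum-applyUpTo-cong n (λ j _ → closeOrOpen j))
    (trans (sum-applyUpTo-+ _ _ n)
           (cong₂ _+_ (sum-applyUpTo-indicator _ (<-trans (n<1+n i) 1+i<n)) (sum-applyUpTo-indicator _ 1+i<n))))
    where
    g : ℕ → List ℕ → ℕ
    g a β = f (suc a ∷ β)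
    closeOrOpen : ∀ j → sumWhere (inBlock i ∘′ (suc j ∷_)) (g j) (tuples k n) ≡
      (if j ≡ᵇ i then sumWhere (blocksFrom (suc (suc i))) (g i) (tuples k n) else 0) +
      (if j ≡ᵇ suc i then sumWhere (inBlock (suc i)) (g (suc i)) (tuples k n) else 0)
    closeOrOpen j with j ≡ᵇ i in eq
    ... | true rewrite ≡ᵇ⇒≡ j i (subst T (sym eq) tt) | <⇒≡ᵇ-false (n<1+n i) = sym (+-identityʳ _)
    ... | false = sumWhere-head j (suc i) (inBlock (suc i)) g (tuples k n)

  countᵇ-++ : ∀ p xs ys → countᵇ p (xs ++ ys) ≡ countᵇ p xs + countᵇ p ys
  countᵇ-++ p xs ys = trans (cong length (filter-++ (T? ∘ p) xs ys)) (length-++ (filterᵇ p xs))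

  countᵇ-none : ∀ {p xs} → All (λ x → ¬ T (p x)) xs → countᵇ p xs ≡ 0
  countᵇ-none {p} none = cong length (filter-none (T? ∘ p) none)

  countᵇ-all : ∀ {p xs} → All (λ x → T (p x)) xs → countᵇ p xs ≡ length xs
  countᵇ-all {p} every = cong length (filter-all (T? ∘ p) every)

  all-cong : ∀ {p q : ℕ → Bool} {xs} → All (λ x → p x ≡ q x) xs → all p xs ≡ all q xs
  all-cong []         = refl
  all-cong (eq ∷ eqs) = cong₂ _∧_ eq (all-cong eqs)

  all-++ : ∀ (p : ℕ → Bool) xs ys → all p (xs ++ ys) ≡ all p xs ∧ all p ys
  all-++ p []       ys = refl
  all-++ p (x ∷ xs) ys = trans (cong (p x ∧_) (all-++ p xs ys)) (sym (∧-assoc (p x) _ _))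

  -- The conditions of fubiniCond and atMostTwice for the values of α lowered by
  -- off, with the counts taken in γ.
  fubiniIn : ℕ → List ℕ → List ℕ → Bool
  fubiniIn off γ α = all (λ a → a ≡ᵇ suc (off + countᵇ (_<ᵇ a) γ)) α

  atMostTwiceIn : List ℕ → List ℕ → Bool
  atMostTwiceIn γ α = all (λ a → countᵇ (_≡ᵇ a) γ ≤ᵇ 2) α

  unitFubiniFrom : ℕ → List ℕ → Bool
  unitFubiniFrom off α = fubiniIn off α α ∧ atMostTwiceIn α α

  unitFubiniFrom-++ : ∀ off pre α a₀ → All (_≤ a₀) pre → All (a₀ <_) α →
    unitFubiniFrom off (pre ++ α) ≡ unitFubiniFrom off pre ∧ unitFubiniFrom (off + length pre) α
  unitFubiniFrom-++ off pre α a₀ pre≤a₀ a₀<α = begin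
    fubiniIn off γ (pre ++ α) ∧ atMostTwiceIn γ (pre ++ α)
      ≡⟨ cong₂ _∧_ (all-++ _ pre α) (all-++ _ pre α) ⟩
    (fubiniIn off γ pre ∧ fubiniIn off γ α) ∧ (atMostTwiceIn γ pre ∧ atMostTwiceIn γ α)
      ≡⟨ cong₂ _∧_
           (cong₂ _∧_ (all-cong (All.map fubini-low pre≤a₀)) (all-cong (All.map fubini-high a₀<α)))
           (cong₂ _∧_ (all-cong (All.map twice-low pre≤a₀)) (all-cong (All.map twice-high a₀<α))) ⟩
    (fubiniIn off pre pre ∧ fubiniIn (off + length pre) α α) ∧ (atMostTwiceIn pre pre ∧ atMostTwiceIn α α)
      ≡⟨ ∧-interchange (fubiniIn off pre pre) _ (atMostTwiceIn pre pre) _ ⟩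
    unitFubiniFrom off pre ∧ unitFubiniFrom (off + length pre) α ∎
    where
    open ≡-Reasoning
    γ = pre ++ α
    fubini-low : ∀ {x} → x ≤ a₀ →
      (x ≡ᵇ suc (off + countᵇ (_<ᵇ x) γ)) ≡ (x ≡ᵇ suc (off + countᵇ (_<ᵇ x) pre))
    fubini-low {x} x≤a₀ = cong (λ c → x ≡ᵇ suc (off + c))
      (trans (countᵇ-++ _ pre α)
      (trans (cong (_ +_)
               (countᵇ-none (All.map (λ a₀<b → ≤⇒¬<ᵇ (≤-trans x≤a₀ (<⇒≤ a₀<b))) a₀<α)))
             (+-identityʳ _)))
    fubini-high : ∀ {x} → a₀ < x →
      (x ≡ᵇ suc (off + countᵇ (_<ᵇ x) γ)) ≡ (x ≡ᵇ suc (off + length pre + countᵇ (_<ᵇ x) α))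
    fubini-high {x} a₀<x = cong (λ c → x ≡ᵇ suc c)
      (trans (cong (off +_) (trans (countᵇ-++ _ pre α) (cong (_+ countᵇ (_<ᵇ x) α)
               (countᵇ-all (All.map (λ b≤a₀ → <⇒<ᵇ (≤-<-trans b≤a₀ a₀<x)) pre≤a₀)))))
             (sym (+-assoc off _ _)))
    twice-low : ∀ {x} → x ≤ a₀ → (countᵇ (_≡ᵇ x) γ ≤ᵇ 2) ≡ (countᵇ (_≡ᵇ x) pre ≤ᵇ 2)
    twice-low x≤a₀ = cong (_≤ᵇ 2)
      (trans (countᵇ-++ _ pre α)
      (trans (cong (_ +_)
               (countᵇ-none (All.map (λ a₀<b → ≢⇒¬≡ᵇ (>⇒≢ (≤-<-trans x≤a₀ a₀<b))) a₀<α)))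
             (+-identityʳ _)))
    twice-high : ∀ {x} → a₀ < x → (countᵇ (_≡ᵇ x) γ ≤ᵇ 2) ≡ (countᵇ (_≡ᵇ x) α ≤ᵇ 2)
    twice-high {x} a₀<x = cong (_≤ᵇ 2)
      (trans (countᵇ-++ _ pre α) (cong (_+ countᵇ (_≡ᵇ x) α)
             (countᵇ-none (All.map (λ b≤a₀ → ≢⇒¬≡ᵇ (<⇒≢ (≤-<-trans b≤a₀ a₀<x))) pre≤a₀))))

  unitFubiniFrom-[a] : ∀ off → unitFubiniFrom off (suc off ∷ []) ≡ true
  unitFubiniFrom-[a] off
    rewrite countᵇ-none {_<ᵇ suc off} {suc off ∷ []} (≤⇒¬<ᵇ (≤-refl {suc off}) ∷ [])
          | +-identityʳ off | ≡ᵇ-refl off = refl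

  unitFubiniFrom-[a,a] : ∀ off → unitFubiniFrom off (suc off ∷ suc off ∷ []) ≡ true
  unitFubiniFrom-[a,a] off
    rewrite countᵇ-none {_<ᵇ suc off} {suc off ∷ suc off ∷ []}
              (≤⇒¬<ᵇ (≤-refl {suc off}) ∷ ≤⇒¬<ᵇ (≤-refl {suc off}) ∷ [])
          | countᵇ-all {_≡ᵇ suc off} {suc off ∷ suc off ∷ []}
              (≡⇒≡ᵇ (suc off) _ refl ∷ ≡⇒≡ᵇ (suc off) _ refl ∷ [])
          | +-identityʳ off | ≡ᵇ-refl off = refl

  unitFubiniFrom-[a,a,a] : ∀ off a β → unitFubiniFrom off (a ∷ a ∷ a ∷ β) ≡ false
  unitFubiniFrom-[a,a,a] off a β =
    trans (cong (λ c → fubiniIn off γ γ ∧ ((c ≤ᵇ 2) ∧ atMostTwiceIn γ (a ∷ a ∷ β))) three-copies)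
          (∧-zeroʳ (fubiniIn off γ γ))
    where
    γ = a ∷ a ∷ a ∷ β
    a≡ᵇa = ≡⇒≡ᵇ a a refl
    three-copies : countᵇ (_≡ᵇ a) γ ≡ 3 + countᵇ (_≡ᵇ a) β
    three-copies = trans (countᵇ-++ (_≡ᵇ a) (a ∷ a ∷ a ∷ []) β)
      (cong (_+ countᵇ (_≡ᵇ a) β)
            (countᵇ-all {_≡ᵇ a} {a ∷ a ∷ a ∷ []} (a≡ᵇa ∷ a≡ᵇa ∷ a≡ᵇa ∷ [])))

  sorted-head≤ : ∀ a β → T (weaklyIncreasing (a ∷ β)) → All (a ≤_) β
  sorted-head≤ a []      _ = []
  sorted-head≤ a (b ∷ β) s with Equivalence.to T-∧ s
  ... | a≤ᵇb , s′ = a≤b ∷ All.map (≤-trans a≤b) (sorted-head≤ b β s′)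
    where a≤b = ≤ᵇ⇒≤ a b a≤ᵇb

  sorted-tail : ∀ a β → T (weaklyIncreasing (a ∷ β)) → T (weaklyIncreasing β)
  sorted-tail a []      _ = tt
  sorted-tail a (b ∷ β) s = proj₂ (Equivalence.to T-∧ s)

  sorted-above : ∀ a b β → T (weaklyIncreasing (a ∷ b ∷ β)) → b ≢ a → All (a <_) (b ∷ β)
  sorted-above a b β s b≢a with sorted-head≤ a (b ∷ β) s
  ... | a≤b ∷ _ = a<b ∷ All.map (<-≤-trans a<b) (sorted-head≤ b β (sorted-tail a (b ∷ β) s))
    where a<b = ≤∧≢⇒< a≤b (b≢a ∘ sym)

  unitFubiniFrom-wrongHead : ∀ off a β → T (weaklyIncreasing (a ∷ β)) → a ≢ suc off →
                             unitFubiniFrom off (a ∷ β) ≡ false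
  unitFubiniFrom-wrongHead off a β s a≢
    rewrite countᵇ-none {_<ᵇ a} {a ∷ β}
              (≤⇒¬<ᵇ (≤-refl {a}) ∷ All.map ≤⇒¬<ᵇ (sorted-head≤ a β s))
          | +-identityʳ off | ≢⇒≡ᵇ-false a≢ = refl

  -- The recursive calls are made before the case splits so that they are visibly
  -- on a sublist of the argument.
  mutual
    unitFubiniFrom≡blocksFrom : ∀ off α → T (weaklyIncreasing α) →
                                unitFubiniFrom off α ≡ blocksFrom off α
    unitFubiniFrom≡blocksFrom off []      _ = refl
    unitFubiniFrom≡blocksFrom off (a ∷ β) s with a ≟ suc off
    ... | yes refl = trans (unitFubiniFrom≡inBlock off β s) (cong (_∧ inBlock off β) (sym (≡ᵇ-refl off)))
    ... | no a≢    = trans (unitFubiniFrom-wrongHead off a β s a≢)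
                           (cong (_∧ inBlock off β) (sym (≢⇒≡ᵇ-false a≢)))

    unitFubiniFrom≡inBlock : ∀ off β → T (weaklyIncreasing (suc off ∷ β)) →
                             unitFubiniFrom off (suc off ∷ β) ≡ inBlock off β
    unitFubiniFrom≡inBlock off []      _ = unitFubiniFrom-[a] off
    unitFubiniFrom≡inBlock off (b ∷ β) s
      with b ≟ suc off | unitFubiniFrom≡blocksFrom (suc off) (b ∷ β) (sorted-tail (suc off) (b ∷ β) s)
    ... | yes refl | _ =
      trans (unitFubiniFrom≡closedBlock off β s)
            (cong (λ t → if t then blocksFrom (suc (suc off)) β else blocksFrom (suc off) (suc off ∷ β))
                  (sym (≡ᵇ-refl off)))
    ... | no b≢ | ih = begin
      unitFubiniFrom off ((suc off ∷ []) ++ b ∷ β)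
        ≡⟨ unitFubiniFrom-++ off (suc off ∷ []) (b ∷ β) (suc off) (≤-refl ∷ [])
             (sorted-above (suc off) b β s b≢) ⟩
      unitFubiniFrom off (suc off ∷ []) ∧ unitFubiniFrom (off + 1) (b ∷ β)
        ≡⟨ cong₂ _∧_ (unitFubiniFrom-[a] off) (cong (λ o → unitFubiniFrom o (b ∷ β)) (+-comm off 1)) ⟩
      unitFubiniFrom (suc off) (b ∷ β)
        ≡⟨ ih ⟩
      blocksFrom (suc off) (b ∷ β)
        ≡⟨ cong (λ t → if t then blocksFrom (suc (suc off)) β else blocksFrom (suc off) (b ∷ β))
                (sym (≢⇒≡ᵇ-false b≢)) ⟩
      inBlock off (b ∷ β) ∎
      where open ≡-Reasoning

    unitFubiniFrom≡closedBlock : ∀ off β → T (weaklyIncreasing (suc off ∷ suc off ∷ β)) →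
                                 unitFubiniFrom off (suc off ∷ suc off ∷ β) ≡ blocksFrom (suc (suc off)) β
    unitFubiniFrom≡closedBlock off []      _ = unitFubiniFrom-[a,a] off
    unitFubiniFrom≡closedBlock off (c ∷ β) s
      with c ≟ suc off | unitFubiniFrom≡blocksFrom (suc (suc off)) (c ∷ β)
                           (sorted-tail (suc off) (c ∷ β) (sorted-tail (suc off) (suc off ∷ c ∷ β) s))
    ... | yes refl | _ =
      trans (unitFubiniFrom-[a,a,a] off (suc off) β)
            (cong (_∧ inBlock (suc (suc off)) β) (sym (<⇒≡ᵇ-false (≤-trans (n<1+n off) (n≤1+n _)))))
    ... | no c≢ | ih = begin
      unitFubiniFrom off ((suc off ∷ suc off ∷ []) ++ c ∷ β)
        ≡⟨ unitFubiniFrom-++ off (suc off ∷ suc off ∷ []) (c ∷ β) (suc off) (≤-refl ∷ ≤-refl ∷ [])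
             (sorted-above (suc off) c β (sorted-tail (suc off) (suc off ∷ c ∷ β) s) c≢) ⟩
      unitFubiniFrom off (suc off ∷ suc off ∷ []) ∧ unitFubiniFrom (off + 2) (c ∷ β)
        ≡⟨ cong₂ _∧_ (unitFubiniFrom-[a,a] off) (cong (λ o → unitFubiniFrom o (c ∷ β)) (+-comm off 2)) ⟩
      unitFubiniFrom (suc (suc off)) (c ∷ β)
        ≡⟨ ih ⟩
      blocksFrom (suc (suc off)) (c ∷ β) ∎
      where open ≡-Reasoning

  mutual
    blocksFrom-sorted : ∀ i x γ → x ≤ suc i → T (blocksFrom i γ) → T (weaklyIncreasing (x ∷ γ))
    blocksFrom-sorted i x []      _   _ = tt
    blocksFrom-sorted i x (a ∷ β) x≤ h with Equivalence.to T-∧ h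
    ... | a≡ᵇ , h′ rewrite ≡ᵇ⇒≡ a (suc i) a≡ᵇ =
      Equivalence.from T-∧ (≤⇒≤ᵇ x≤ , inBlock-sorted i β h′)

    inBlock-sorted : ∀ i γ → T (inBlock i γ) → T (weaklyIncreasing (suc i ∷ γ))
    inBlock-sorted i []      _ = tt
    inBlock-sorted i (b ∷ β) h
      with b ≡ᵇ suc i in eq | blocksFrom-sorted (suc i) (suc i) (b ∷ β) (n≤1+n (suc i))
    ... | true | _ rewrite ≡ᵇ⇒≡ b (suc i) (subst T (sym eq) tt) =
      Equivalence.from T-∧
        (≤⇒≤ᵇ (≤-refl {suc i}) ,
         blocksFrom-sorted (suc (suc i)) (suc i) β (≤-trans (n≤1+n (suc i)) (n≤1+n (suc (suc i)))) h)
    ... | false | nextBlock-sorted = nextBlock-sorted h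

  isUFR↑≡blocksFrom-0 : ∀ α → isUFR↑ α ≡ blocksFrom 0 α
  isUFR↑≡blocksFrom-0 α with weaklyIncreasing α in sorted
  ... | true  = unitFubiniFrom≡blocksFrom 0 α (subst T (sym sorted) tt)
  ... | false with blocksFrom 0 α in blocks
  ...   | false = refl
  ...   | true  =
    ⊥-elim (subst T sorted (sorted-tail 0 α (blocksFrom-sorted 0 0 α z≤n (subst T (sym blocks) tt))))

  -- Lucky cars

  filled : ℕ → List ℕ
  filled zero    = []
  filled (suc i) = suc i ∷ filled i

  luckyAfter : ℕ → List ℕ → ℕ
  luckyAfter i β = luckyFrom (i + length β) (filled i) β

  elemᵇ-filled-above : ∀ {i x} → i < x → elemᵇ x (filled i) ≡ false
  elemᵇ-filled-above {zero}  _   = refl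
  elemᵇ-filled-above {suc i} i<x rewrite <⇒≡ᵇ-false i<x = elemᵇ-filled-above (<-trans (n<1+n i) i<x)

  elemᵇ-filled-top : ∀ i → elemᵇ (suc i) (filled (suc i)) ≡ true
  elemᵇ-filled-top i rewrite ≡ᵇ-refl i = refl

  m<n⇒n∸m≡1+[n∸1+m] : ∀ {m n} → m < n → n ∸ m ≡ suc (n ∸ suc m)
  m<n⇒n∸m≡1+[n∸1+m] = +-∸-assoc 1

  luckyFrom-free : ∀ {N occ a} β → elemᵇ a occ ≡ false → a ≤ N →
                   luckyFrom N occ (a ∷ β) ≡ suc (luckyFrom N (a ∷ occ) β)
  luckyFrom-free β free a≤N rewrite +-∸-assoc 1 a≤N | free = refl

  luckyFrom-bumped : ∀ {N occ a} β → elemᵇ a occ ≡ true → elemᵇ (suc a) occ ≡ false → a < N →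
                     luckyFrom N occ (a ∷ β) ≡ luckyFrom N (suc a ∷ occ) β
  luckyFrom-bumped β taken free a<N
    rewrite +-∸-assoc 1 (<⇒≤ a<N) | taken | m<n⇒n∸m≡1+[n∸1+m] a<N | free = refl

  luckyAfter-free : ∀ i β → luckyAfter i (suc i ∷ β) ≡ suc (luckyAfter (suc i) β)
  luckyAfter-free i β =
    trans (luckyFrom-free β (elemᵇ-filled-above (n<1+n i)) (m<m+n i z<s))
          (cong (λ N → suc (luckyFrom N (filled (suc i)) β)) (+-suc i (length β)))

  luckyAfter-bumped : ∀ i β → luckyAfter (suc i) (suc i ∷ β) ≡ luckyAfter (suc (suc i)) β
  luckyAfter-bumped i β =
    trans (luckyFrom-bumped β (elemᵇ-filled-top i) (elemᵇ-filled-above (n<1+n (suc i))) (m<m+n (suc i) z<s))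
          (cong (λ N → luckyFrom N (filled (suc (suc i))) β) (+-suc (suc i) (length β)))

  -- the total number of parts of the compositions of k into parts 1 and 2
  totalParts : ℕ → ℕ
  totalParts zero          = 0
  totalParts (suc zero)    = 1
  totalParts (suc (suc k)) = (F (suc (suc k)) + totalParts (suc k)) + (F (suc k) + totalParts k)

  i+[1+k]≡n⇒i<n : ∀ {i k n} → i + suc k ≡ n → i < n
  i+[1+k]≡n⇒i<n {i} i+k≡n = subst (i <_) i+k≡n (m<m+n i z<s)

  i+[1+k]≡n⇒1+i+k≡n : ∀ {i k n} → i + suc k ≡ n → suc i + k ≡ n
  i+[1+k]≡n⇒1+i+k≡n {i} {k} i+k≡n = trans (sym (+-suc i k)) i+k≡n

  mutual
    count-blocksFrom : ∀ {n} i k → i + k ≡ n →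
                       sumWhere (blocksFrom i) (λ _ → 1) (tuples k n) ≡ F (suc k)
    count-blocksFrom i zero    _     = refl
    count-blocksFrom i (suc k) i+k≡n =
      trans (sumWhere-blocksFrom-tuples _ k (i+[1+k]≡n⇒i<n i+k≡n))
            (count-inBlock i k (i+[1+k]≡n⇒1+i+k≡n i+k≡n))

    count-inBlock : ∀ {n} i k → suc i + k ≡ n →
                    sumWhere (inBlock i) (λ _ → 1) (tuples k n) ≡ F (suc (suc k))
    count-inBlock i zero    _     = refl
    count-inBlock i (suc k) i+k≡n =
      trans (sumWhere-inBlock-tuples _ k (i+[1+k]≡n⇒i<n {suc i} i+k≡n))
      (trans (cong₂ _+_ (count-blocksFrom (suc (suc i)) k next) (count-inBlock (suc i) k next))
             (+-comm (F (suc k)) _))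
      where next = i+[1+k]≡n⇒1+i+k≡n {suc i} i+k≡n

  mutual
    lucky-blocksFrom : ∀ {n} i k → i + k ≡ n →
                       sumWhere (blocksFrom i) (luckyAfter i) (tuples k n) ≡ totalParts k
    lucky-blocksFrom i zero    _     = refl
    lucky-blocksFrom i (suc k) i+k≡n =
      trans (sumWhere-blocksFrom-tuples _ k (i+[1+k]≡n⇒i<n i+k≡n))
            (lucky-inBlock i k (i+[1+k]≡n⇒1+i+k≡n i+k≡n))

    lucky-inBlock : ∀ {n} i k → suc i + k ≡ n →
      sumWhere (inBlock i) (λ β → luckyAfter i (suc i ∷ β)) (tuples k n) ≡ totalParts (suc k)
    lucky-inBlock i zero    _     = cong (_+ 0) (luckyAfter-free i [])
    lucky-inBlock {n} i (suc k) i+k≡n = begin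
      sumWhere (inBlock i) (λ β → luckyAfter i (suc i ∷ β)) (tuples (suc k) n)
        ≡⟨ sumWhere-inBlock-tuples _ k (i+[1+k]≡n⇒i<n {suc i} i+k≡n) ⟩
      sumWhere (blocksFrom (suc (suc i))) (λ β → luckyAfter i (suc i ∷ suc i ∷ β)) (tuples k n) +
      sumWhere (inBlock (suc i)) (λ β → luckyAfter i (suc i ∷ suc (suc i) ∷ β)) (tuples k n)
        ≡⟨ cong₂ _+_ (sumWhere-cong (tuples k n) (λ _ → refl) closing)
                     (sumWhere-cong (tuples k n) (λ _ → refl) opening) ⟩
      sumWhere (blocksFrom (suc (suc i))) (λ β → 1 + luckyAfter (suc (suc i)) β) (tuples k n) +
      sumWhere (inBlock (suc i)) (λ β → 1 + luckyAfter (suc i) (suc (suc i) ∷ β)) (tuples k n)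
        ≡⟨ cong₂ _+_ (sumWhere-+ _ (λ _ → 1) _ (tuples k n)) (sumWhere-+ _ (λ _ → 1) _ (tuples k n)) ⟩
      (sumWhere (blocksFrom (suc (suc i))) (λ _ → 1) (tuples k n) +
       sumWhere (blocksFrom (suc (suc i))) (luckyAfter (suc (suc i))) (tuples k n)) +
      (sumWhere (inBlock (suc i)) (λ _ → 1) (tuples k n) +
       sumWhere (inBlock (suc i)) (λ β → luckyAfter (suc i) (suc (suc i) ∷ β)) (tuples k n))
        ≡⟨ cong₂ _+_
             (cong₂ _+_ (count-blocksFrom (suc (suc i)) k next) (lucky-blocksFrom (suc (suc i)) k next))
             (cong₂ _+_ (count-inBlock (suc i) k next) (lucky-inBlock (suc i) k next)) ⟩
      (F (suc k) + totalParts k) + (F (suc (suc k)) + totalParts (suc k))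
        ≡⟨ +-comm (F (suc k) + totalParts k) _ ⟩
      totalParts (suc (suc k)) ∎
      where
      open ≡-Reasoning
      next = i+[1+k]≡n⇒1+i+k≡n {suc i} i+k≡n
      closing : ∀ β → luckyAfter i (suc i ∷ suc i ∷ β) ≡ 1 + luckyAfter (suc (suc i)) β
      closing β = trans (luckyAfter-free i (suc i ∷ β)) (cong suc (luckyAfter-bumped i β))
      opening : ∀ β →
                luckyAfter i (suc i ∷ suc (suc i) ∷ β) ≡ 1 + luckyAfter (suc i) (suc (suc i) ∷ β)
      opening β = luckyAfter-free i (suc (suc i) ∷ β)

  length-UFR↑ : ∀ n → length (UFR↑ n) ≡ F (suc n)
  length-UFR↑ n =
    trans (length-filterᵇ isUFR↑ (tuples n n))
    (trans (sumWhere-cong (tuples n n) isUFR↑≡blocksFrom-0 (λ _ → refl)) (count-blocksFrom 0 n refl))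

  sum-lucky-UFR↑ : ∀ n → sum (map lucky (UFR↑ n)) ≡ totalParts n
  sum-lucky-UFR↑ n =
    trans (sum-map-filterᵇ isUFR↑ lucky (tuples n n))
    (trans (sumWhere-cong (tuples n n) isUFR↑≡blocksFrom-0 (λ _ → refl)) (lucky-blocksFrom 0 n refl))

  expectedLucky≡ratio : ∀ n → expectedLucky n ≡ ratio (totalParts n) (F (suc n))
  expectedLucky≡ratio n = cong₂ ratio (sum-lucky-UFR↑ n) (length-UFR↑ n)

module ClosedForm where
  open Counting using (totalParts; sum-applyUpTo-cong; sum-applyUpTo-+; sum-map-suc-upTo)
  open import Defs
  open import Data.List using (map; upTo; applyUpTo; [_])
  open import Data.List.Properties using (applyUpTo-∷ʳ)
  open import Data.Nat using (ℕ; zero; suc; _+_; _*_; _∸_; _≤_; _<_; z≤n; s≤s)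
  open import Data.Nat.Combinatorics using (_C_; nCk+nC[k+1]≡[n+1]C[k+1])
  open import Data.Nat.ListAction using (sum)
  open import Data.Nat.ListAction.Properties using (sum-++)
  open import Data.Nat.Properties
  open import Data.Nat.Tactic.RingSolver using (solve-∀)
  open import Data.Sum using (_⊎_; inj₁; inj₂)
  open import Relation.Binary.PropositionalEquality hiding ([_])
  open ≡-Reasoning

  -- the number of compositions of n into k parts 1 and 2
  compositions : ℕ → ℕ → ℕ
  compositions zero          zero    = 1
  compositions zero          (suc k) = 0
  compositions (suc n)       zero    = 0
  compositions (suc zero)    (suc k) = compositions zero k
  compositions (suc (suc n)) (suc k) = compositions (suc n) k + compositions n k

  compositions-< : ∀ n k → n < k → compositions n k ≡ 0
  compositions-< zero          (suc k)       _         = refl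
  compositions-< (suc zero)    (suc zero)    (s≤s ())
  compositions-< (suc zero)    (suc (suc k)) _         = refl
  compositions-< (suc (suc n)) (suc k)       (s≤s n<k) =
    cong₂ _+_ (compositions-< (suc n) k n<k) (compositions-< n k (<-trans (n<1+n n) n<k))

  compositions-diag : ∀ n → compositions n n ≡ 1
  compositions-diag zero          = refl
  compositions-diag (suc zero)    = refl
  compositions-diag (suc (suc n)) =
    cong₂ _+_ (compositions-diag (suc n)) (compositions-< n (suc n) (n<1+n n))

  compositions≡C : ∀ n k → k ≤ n → compositions n k ≡ k C (n ∸ k)
  compositions≡C zero          zero          _ = refl
  compositions≡C (suc n)       zero          _ = refl
  compositions≡C (suc zero)    (suc zero)    _ = refl
  compositions≡C (suc zero)    (suc (suc k)) (s≤s ())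
  compositions≡C (suc (suc n)) (suc k)       (s≤s k≤1+n) with m≤n⇒m<n∨m≡n k≤1+n
  ... | inj₁ (s≤s k≤n) = begin
    compositions (suc n) k + compositions n k
      ≡⟨ cong₂ _+_ (compositions≡C (suc n) k k≤1+n) (compositions≡C n k k≤n) ⟩
    k C (suc n ∸ k) + k C (n ∸ k)   ≡⟨ cong (λ m → k C m + k C (n ∸ k)) (+-∸-assoc 1 k≤n) ⟩
    k C suc (n ∸ k) + k C (n ∸ k)   ≡⟨ +-comm (k C suc (n ∸ k)) _ ⟩
    k C (n ∸ k) + k C suc (n ∸ k)   ≡⟨ nCk+nC[k+1]≡[n+1]C[k+1] k (n ∸ k) ⟩
    suc k C suc (n ∸ k)             ≡⟨ cong (suc k C_) (+-∸-assoc 1 k≤n) ⟨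
    suc k C (suc n ∸ k)             ∎
  ... | inj₂ refl = begin
    compositions (suc n) (suc n) + compositions n (suc n)
      ≡⟨ cong₂ _+_ (compositions-diag (suc n)) (compositions-< n (suc n) (n<1+n n)) ⟩
    suc (suc n) C 0                 ≡⟨ cong (suc (suc n) C_) (n∸n≡0 n) ⟨
    suc (suc n) C (suc n ∸ suc n)   ∎

  sum-applyUpTo-suc : ∀ f n → sum (applyUpTo f (suc n)) ≡ sum (applyUpTo f n) + f n
  sum-applyUpTo-suc f n =
    trans (cong sum (sym (applyUpTo-∷ʳ f n)))
          (trans (sum-++ (applyUpTo f n) [ f n ]) (cong (sum (applyUpTo f n) +_) (+-identityʳ (f n))))

  Σcompositions : ℕ → ℕ
  Σcompositions n = sum (applyUpTo (compositions n) (suc n))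

  Σk·compositions : ℕ → ℕ
  Σk·compositions n = sum (applyUpTo (λ i → suc i * compositions n (suc i)) n)

  Σcompositions-rec : ∀ n → Σcompositions (suc (suc n)) ≡ Σcompositions (suc n) + Σcompositions n
  Σcompositions-rec n = begin
    sum (applyUpTo (λ i → compositions (suc n) i + compositions n i) (suc (suc n)))
      ≡⟨ sum-applyUpTo-+ (compositions (suc n)) (compositions n) (suc (suc n)) ⟩
    Σcompositions (suc n) + sum (applyUpTo (compositions n) (suc (suc n)))
      ≡⟨ cong (Σcompositions (suc n) +_) (sum-applyUpTo-suc (compositions n) (suc n)) ⟩
    Σcompositions (suc n) + (Σcompositions n + compositions n (suc n))
      ≡⟨ cong (λ c → Σcompositions (suc n) + (Σcompositions n + c)) (compositions-< n (suc n) (n<1+n n)) ⟩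
    Σcompositions (suc n) + (Σcompositions n + 0)
      ≡⟨ cong (Σcompositions (suc n) +_) (+-identityʳ (Σcompositions n)) ⟩
    Σcompositions (suc n) + Σcompositions n ∎

  Σcompositions≡F : ∀ n → Σcompositions n ≡ F (suc n)
  Σcompositions≡F zero          = refl
  Σcompositions≡F (suc zero)    = refl
  Σcompositions≡F (suc (suc n)) =
    trans (Σcompositions-rec n) (cong₂ _+_ (Σcompositions≡F (suc n)) (Σcompositions≡F n))

  Σ[1+k]·compositions : ∀ m → sum (applyUpTo (λ i → suc i * compositions m i) (suc m)) ≡
                              Σcompositions m + Σk·compositions m
  Σ[1+k]·compositions m = sum-applyUpTo-+ (compositions m) (λ i → i * compositions m i) (suc m)

  Σk·compositions-rec : ∀ n → Σk·compositions (suc (suc n)) ≡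
    (Σcompositions (suc n) + Σk·compositions (suc n)) + (Σcompositions n + Σk·compositions n)
  Σk·compositions-rec n = begin
    sum (applyUpTo (λ i → suc i * (compositions (suc n) i + compositions n i)) (suc (suc n)))
      ≡⟨ sum-applyUpTo-cong (suc (suc n))
           (λ i _ → *-distribˡ-+ (suc i) (compositions (suc n) i) (compositions n i)) ⟩
    sum (applyUpTo (λ i → suc i * compositions (suc n) i + suc i * compositions n i) (suc (suc n)))
      ≡⟨ sum-applyUpTo-+ (λ i → suc i * compositions (suc n) i) (λ i → suc i * compositions n i)
                         (suc (suc n)) ⟩
    sum (applyUpTo (λ i → suc i * compositions (suc n) i) (suc (suc n))) +
    sum (applyUpTo (λ i → suc i * compositions n i) (suc (suc n)))
      ≡⟨ cong₂ _+_ (Σ[1+k]·compositions (suc n))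
                   (sum-applyUpTo-suc (λ i → suc i * compositions n i) (suc n)) ⟩
    previous + (sum (applyUpTo (λ i → suc i * compositions n i) (suc n)) + suc (suc n) * compositions n (suc n))
      ≡⟨ cong₂ (λ s c → previous + (s + suc (suc n) * c))
               (Σ[1+k]·compositions n) (compositions-< n (suc n) (n<1+n n)) ⟩
    previous + ((Σcompositions n + Σk·compositions n) + suc (suc n) * 0)
      ≡⟨ cong (λ c → previous + ((Σcompositions n + Σk·compositions n) + c)) (*-zeroʳ (suc (suc n))) ⟩
    previous + ((Σcompositions n + Σk·compositions n) + 0)
      ≡⟨ cong (previous +_) (+-identityʳ _) ⟩
    previous + (Σcompositions n + Σk·compositions n) ∎
    where previous = Σcompositions (suc n) + Σk·compositions (suc n)

  Σk·compositions≡totalParts : ∀ n → Σk·compositions n ≡ totalParts n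
  Σk·compositions≡totalParts zero          = refl
  Σk·compositions≡totalParts (suc zero)    = refl
  Σk·compositions≡totalParts (suc (suc n)) =
    trans (Σk·compositions-rec n)
          (cong₂ _+_ (cong₂ _+_ (Σcompositions≡F (suc n)) (Σk·compositions≡totalParts (suc n)))
                     (cong₂ _+_ (Σcompositions≡F n) (Σk·compositions≡totalParts n)))

  closedSum≡totalParts : ∀ n → sum (map (λ k → k * (k C (n ∸ k))) (map suc (upTo n))) ≡ totalParts n
  closedSum≡totalParts n =
    trans (sum-map-suc-upTo (λ k → k * (k C (n ∸ k))) n)
    (trans (sum-applyUpTo-cong n (λ i i<n → cong (suc i *_) (sym (compositions≡C n (suc i) i<n))))
           (Σk·compositions≡totalParts n))

  5*totalParts : ∀ n → 5 * totalParts n ≡ 3 * n * F (suc n) + suc n * F n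
  5*totalParts zero          = refl
  5*totalParts (suc zero)    = refl
  5*totalParts (suc (suc n)) = begin
    5 * ((y + x + totalParts (suc n)) + (y + totalParts n))
      ≡⟨ distribute (y + x) (totalParts (suc n)) y (totalParts n) ⟩
    5 * (y + x) + 5 * totalParts (suc n) + (5 * y + 5 * totalParts n)
      ≡⟨ cong₂ (λ s t → 5 * (y + x) + s + (5 * y + t)) (5*totalParts (suc n)) (5*totalParts n) ⟩
    5 * (y + x) + (3 * suc n * (y + x) + suc (suc n) * y) + (5 * y + (3 * n * y + suc n * x))
      ≡⟨ collect n x y ⟩
    3 * suc (suc n) * (y + x + y) + suc (suc (suc n)) * (y + x) ∎
    where
    x = F n
    y = F (suc n)
    distribute : ∀ a b c d → 5 * (a + b + (c + d)) ≡ 5 * a + 5 * b + (5 * c + 5 * d)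
    distribute = solve-∀
    collect : ∀ n x y →
      5 * (y + x) + (3 * suc n * (y + x) + suc (suc n) * y) + (5 * y + (3 * n * y + suc n * x)) ≡
      3 * suc (suc n) * (y + x + y) + suc (suc (suc n)) * (y + x)
    collect = solve-∀

  cassini : ∀ n → F (suc n) * F (suc n) ≡ F n * F (suc n) + F n * F n + 1
                ⊎ F (suc n) * F (suc n) + 1 ≡ F n * F (suc n) + F n * F n
  cassini zero    = inj₁ refl
  cassini (suc n) with cassini n
  ... | inj₁ y²≡xy+x²+1 = inj₂ (begin
    (y + x) * (y + x) + 1                ≡⟨ expand x y ⟩
    (x * y + x * x + 1) + x * y + y * y  ≡⟨ cong (λ s → s + x * y + y * y) y²≡xy+x²+1 ⟨
    y * y + x * y + y * y                ≡⟨ collect x y ⟩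
    y * (y + x) + y * y                  ∎)
    where
    x = F n
    y = F (suc n)
    expand : ∀ x y → (y + x) * (y + x) + 1 ≡ (x * y + x * x + 1) + x * y + y * y
    expand = solve-∀
    collect : ∀ x y → y * y + x * y + y * y ≡ y * (y + x) + y * y
    collect = solve-∀
  ... | inj₂ y²+1≡xy+x² = inj₁ (begin
    (y + x) * (y + x)                    ≡⟨ expand x y ⟩
    (x * y + x * x) + x * y + y * y      ≡⟨ cong (λ s → s + x * y + y * y) y²+1≡xy+x² ⟨
    (y * y + 1) + x * y + y * y          ≡⟨ collect x y ⟩
    y * (y + x) + y * y + 1              ∎)
    where
    x = F n
    y = F (suc n)
    expand : ∀ x y → (y + x) * (y + x) ≡ (x * y + x * x) + x * y + y * y
    expand = solve-∀
    collect : ∀ x y → (y * y + 1) + x * y + y * y ≡ y * (y + x) + y * y + 1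
    collect = solve-∀

  F-mono : ∀ n → F n ≤ F (suc n)
  F-mono zero          = z≤n
  F-mono (suc zero)    = ≤-refl
  F-mono (suc (suc n)) = m≤m+n (F (suc (suc n))) (F (suc n))

  F-pos : ∀ n → 1 ≤ F (suc n)
  F-pos zero    = ≤-refl
  F-pos (suc n) = ≤-trans (F-pos n) (F-mono (suc n))

  n≤F[1+n] : ∀ n → n ≤ F (suc n)
  n≤F[1+n] zero          = z≤n
  n≤F[1+n] (suc zero)    = ≤-refl
  n≤F[1+n] (suc (suc n)) =
    subst (_≤ F (suc (suc (suc n)))) (+-comm (suc n) 1) (+-mono-≤ (n≤F[1+n] (suc n)) (F-pos n))

module Asymptotics where
  open Counting using (totalParts; expectedLucky≡ratio)
  open ClosedForm using (5*totalParts; cassini; F-pos; n≤F[1+n])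
  open import Defs
  open import Data.Integer as ℤ using (+_; +[1+_]; +0; -[1+_])
  import Data.Integer.Properties as ℤ
  open import Data.Nat as ℕ using (ℕ; zero; suc; s≤s; z≤n)
  import Data.Nat.Properties as ℕ
  open import Data.Product using (_×_; _,_; ∃; proj₁; proj₂)
  open import Data.Rational
  open import Data.Rational.Properties
  import Data.Rational.Unnormalised as ℚᵘ
  import Data.Rational.Unnormalised.Properties as ℚᵘ
  open import Data.Sum as ⊎ using (_⊎_; inj₁; inj₂)
  open import Level using (0ℓ)
  open import Relation.Binary.Definitions using (tri<; tri≈; tri>)
  open import Relation.Binary.PropositionalEquality
  open import Relation.Nullary using (yes; no)
  open import Relation.Nullary.Decidable using (dec⇒maybe)
  open import Tactic.RingSolver using (solve-∀)
  open import Tactic.RingSolver.Core.AlmostCommutativeRing using (AlmostCommutativeRing; fromCommutativeRing)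

  ℚ-ring : AlmostCommutativeRing 0ℓ 0ℓ
  ℚ-ring = fromCommutativeRing +-*-commutativeRing (λ x → dec⇒maybe (0ℚ ≟ x))

  2ℚ 3ℚ 4ℚ 5ℚ : ℚ
  2ℚ = + 2 / 1
  3ℚ = + 3 / 1
  4ℚ = + 4 / 1
  5ℚ = + 5 / 1

  q-p+p≡q : ∀ p q → q - p + p ≡ q
  q-p+p≡q = solve-∀ ℚ-ring

  p≤q⇒0≤q-p : ∀ {p q} → p ≤ q → 0ℚ ≤ q - p
  p≤q⇒0≤q-p {p} {q} p≤q = subst (_≤ q - p) (+-inverseʳ p) (+-monoˡ-≤ (- p) p≤q)

  0≤q-p⇒p≤q : ∀ {p q} → 0ℚ ≤ q - p → p ≤ q
  0≤q-p⇒p≤q {p} {q} 0≤q-p = subst₂ _≤_ (+-identityˡ p) (q-p+p≡q p q) (+-monoˡ-≤ p 0≤q-p)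

  p<q⇒0<q-p : ∀ {p q} → p < q → 0ℚ < q - p
  p<q⇒0<q-p {p} {q} p<q = subst (_< q - p) (+-inverseʳ p) (+-monoˡ-< (- p) p<q)

  0<q-p⇒p<q : ∀ {p q} → 0ℚ < q - p → p < q
  0<q-p⇒p<q {p} {q} 0<q-p = subst₂ _<_ (+-identityˡ p) (q-p+p≡q p q) (+-monoˡ-< p 0<q-p)

  nonNeg+nonNeg : ∀ {p q} → 0ℚ ≤ p → 0ℚ ≤ q → 0ℚ ≤ p + q
  nonNeg+nonNeg = +-mono-≤

  pos+nonNeg : ∀ {p q} → 0ℚ < p → 0ℚ ≤ q → 0ℚ < p + q
  pos+nonNeg = +-mono-<-≤

  nonNeg+pos : ∀ {p q} → 0ℚ ≤ p → 0ℚ < q → 0ℚ < p + q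
  nonNeg+pos = +-mono-≤-<

  nonNeg*nonNeg : ∀ {p q} → 0ℚ ≤ p → 0ℚ ≤ q → 0ℚ ≤ p * q
  nonNeg*nonNeg {p} {q} 0≤p 0≤q =
    nonNegative⁻¹ _ {{nonNeg*nonNeg⇒nonNeg p {{nonNegative 0≤p}} q {{nonNegative 0≤q}}}}

  pos*pos : ∀ {p q} → 0ℚ < p → 0ℚ < q → 0ℚ < p * q
  pos*pos {p} {q} 0<p 0<q = positive⁻¹ _ {{pos*pos⇒pos p {{positive 0<p}} q {{positive 0<q}}}}

  square-nonNeg : ∀ p → 0ℚ ≤ p * p
  square-nonNeg p with <-cmp p 0ℚ
  ... | tri< p<0 _ _ = <⇒≤ (positive⁻¹ _ {{neg*neg⇒pos p {{negative p<0}} p {{negative p<0}}}})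
  ... | tri≈ _ refl _ = ≤-refl
  ... | tri> _ _ 0<p = <⇒≤ (pos*pos 0<p 0<p)

  neg≤nonNeg : ∀ {p q} → 0ℚ ≤ p → 0ℚ ≤ q → - p ≤ q
  neg≤nonNeg 0≤p 0≤q = ≤-trans (neg-antimono-≤ 0≤p) 0≤q

  toℚᵘ-/ : ∀ s c → toℚᵘ (+ s / suc c) ℚᵘ.≃ ℚᵘ.mkℚᵘ (+ s) c
  toℚᵘ-/ s c = toℚᵘ-fromℚᵘ (ℚᵘ.mkℚᵘ (+ s) c)

  /1-+ : ∀ m n → + (m ℕ.+ n) / 1 ≡ + m / 1 + + n / 1
  /1-+ m n = toℚᵘ-injective (ℚᵘ.≃-trans (toℚᵘ-/ (m ℕ.+ n) 0) (ℚᵘ.≃-sym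
    (ℚᵘ.≃-trans (toℚᵘ-homo-+ (+ m / 1) (+ n / 1))
    (ℚᵘ.≃-trans (ℚᵘ.+-cong (toℚᵘ-/ m 0) (toℚᵘ-/ n 0)) (ℚᵘ.*≡* eq)))))
    where
    eq : (+ m ℤ.* + 1 ℤ.+ + n ℤ.* + 1) ℤ.* + 1 ≡ + (m ℕ.+ n) ℤ.* + 1
    eq rewrite ℤ.*-identityʳ (+ m) | ℤ.*-identityʳ (+ n) | ℤ.*-identityʳ (+ m ℤ.+ + n) = sym (ℤ.pos-+ m n)

  /1-* : ∀ m n → + (m ℕ.* n) / 1 ≡ (+ m / 1) * (+ n / 1)
  /1-* m n = toℚᵘ-injective (ℚᵘ.≃-trans (toℚᵘ-/ (m ℕ.* n) 0) (ℚᵘ.≃-sym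
    (ℚᵘ.≃-trans (toℚᵘ-homo-* (+ m / 1) (+ n / 1))
    (ℚᵘ.≃-trans (ℚᵘ.*-cong (toℚᵘ-/ m 0) (toℚᵘ-/ n 0)) (ℚᵘ.*≡* eq)))))
    where
    eq : (+ m ℤ.* + n) ℤ.* + 1 ≡ + (m ℕ.* n) ℤ.* + 1
    eq rewrite ℤ.*-identityʳ (+ m ℤ.* + n) | ℤ.*-identityʳ (+ (m ℕ.* n)) = sym (ℤ.pos-* m n)

  /1-mono-≤ : ∀ {m n} → m ℕ.≤ n → + m / 1 ≤ + n / 1
  /1-mono-≤ {m} {n} m≤n = toℚᵘ-cancel-≤ (ℚᵘ.≤-respʳ-≃ (ℚᵘ.≃-sym (toℚᵘ-/ n 0))
    (ℚᵘ.≤-respˡ-≃ (ℚᵘ.≃-sym (toℚᵘ-/ m 0)) (ℚᵘ.*≤* (ℤ.*-monoʳ-≤-nonNeg (+ 1) (ℤ.+≤+ m≤n)))))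

  ratio-split : ∀ s {d} → 1 ℕ.≤ d → ratio s d ≡ + s / 1 * ratio 1 d
  ratio-split s {suc c} _ = toℚᵘ-injective (ℚᵘ.≃-trans (toℚᵘ-/ s c) (ℚᵘ.≃-sym
    (ℚᵘ.≃-trans (toℚᵘ-homo-* (+ s / 1) (+ 1 / suc c))
    (ℚᵘ.≃-trans (ℚᵘ.*-cong (toℚᵘ-/ s 0) (toℚᵘ-/ 1 c)) (ℚᵘ.*≡* eq)))))
    where
    eq : (+ s ℤ.* + 1) ℤ.* + suc c ≡ + s ℤ.* + suc (c ℕ.+ 0)
    eq rewrite ℕ.+-identityʳ c | ℤ.*-identityʳ (+ s) = refl

  ratio-inverse : ∀ {d} → 1 ℕ.≤ d → + d / 1 * ratio 1 d ≡ 1ℚ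
  ratio-inverse {suc c} _ = toℚᵘ-injective (ℚᵘ.≃-trans (toℚᵘ-homo-* (+ suc c / 1) (+ 1 / suc c))
    (ℚᵘ.≃-trans (ℚᵘ.*-cong (toℚᵘ-/ (suc c) 0) (toℚᵘ-/ 1 c)) (ℚᵘ.*≡* eq)))
    where
    eq : (+ suc c ℤ.* + 1) ℤ.* + 1 ≡ + 1 ℤ.* + suc (c ℕ.+ 0)
    eq = trans (ℤ.*-identityʳ _) (trans (ℤ.*-identityʳ _)
           (trans (cong (λ k → + suc k) (sym (ℕ.+-identityʳ c))) (sym (ℤ.*-identityˡ _))))

  ratio-nonNeg : ∀ s d → 0ℚ ≤ ratio s d
  ratio-nonNeg s zero    = ≤-refl
  ratio-nonNeg s (suc c) = nonNegative⁻¹ _ {{normalize-nonNeg s (suc c)}}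

  unitFraction-pos : ∀ m → 0ℚ < + 1 / suc m
  unitFraction-pos m = positive⁻¹ _ {{normalize-pos 1 (suc m)}}

  1/[1+m]≤k/[1+m] : ∀ {k} m → 1 ℕ.≤ k → + 1 / suc m ≤ + k / 1 * ratio 1 (suc m)
  1/[1+m]≤k/[1+m] {k} m 1≤k = begin
    + 1 / suc m                ≡⟨ *-identityˡ _ ⟨
    1ℚ * ratio 1 (suc m)       ≤⟨ *-monoʳ-≤-nonNeg (ratio 1 (suc m)) {{nonNegative (ratio-nonNeg 1 (suc m))}}
                                    (/1-mono-≤ 1≤k) ⟩
    + k / 1 * ratio 1 (suc m)  ∎
    where open ≤-Reasoning

  unitFraction≤1 : ∀ m → + 1 / suc m ≤ 1ℚ
  unitFraction≤1 m =
    subst (+ 1 / suc m ≤_) (ratio-inverse {suc m} (s≤s z≤n)) (1/[1+m]≤k/[1+m] {suc m} m (s≤s z≤n))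

  ∃unitFraction≤ : ∀ ε → 0ℚ < ε → ∃ λ m → + 1 / suc m ≤ ε
  ∃unitFraction≤ (mkℚ +0 _ _)          (*<* (ℤ.+<+ ()))
  ∃unitFraction≤ (mkℚ -[1+ _ ] _ _)    (*<* ())
  ∃unitFraction≤ ε@(mkℚ +[1+ p ] m _) _ =
    m , subst (+ 1 / suc m ≤_) (trans (sym (ratio-split (suc p) (s≤s z≤n))) (↥p/↧p≡p ε))
              (1/[1+m]≤k/[1+m] {suc p} m (s≤s z≤n))

  -- Signs in ℚ(√5)

  evalAt : ℚ → ℚ5 → ℚ
  evalAt r (a , b) = a + b * r

  evalAt-ι : ∀ r q → evalAt r (ι q) ≡ q
  evalAt-ι r q = eq q r
    where eq : ∀ q r → q + 0ℚ * r ≡ q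
          eq = solve-∀ ℚ-ring

  evalAt-√5 : ∀ r → evalAt r √5 ≡ r
  evalAt-√5 r = eq r
    where eq : ∀ r → 0ℚ + 1ℚ * r ≡ r
          eq = solve-∀ ℚ-ring

  evalAt-+ : ∀ r x y → evalAt r (x +₅ y) ≡ evalAt r x + evalAt r y
  evalAt-+ r (a , b) (c , d) = eq a b c d r
    where eq : ∀ a b c d r → a + c + (b + d) * r ≡ (a + b * r) + (c + d * r)
          eq = solve-∀ ℚ-ring

  evalAt-- : ∀ r x y → evalAt r (x -₅ y) ≡ evalAt r x - evalAt r y
  evalAt-- r (a , b) (c , d) = eq a b c d r
    where eq : ∀ a b c d r → a - c + (b - d) * r ≡ (a + b * r) - (c + d * r)
          eq = solve-∀ ℚ-ring

  evalAt-ι* : ∀ r q x → evalAt r (ι q *₅ x) ≡ q * evalAt r x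
  evalAt-ι* r q (c , d) = eq q c d r
    where eq : ∀ q c d r → q * c + 5ℚ * (0ℚ * d) + (q * d + 0ℚ * c) * r ≡ q * (c + d * r)
          eq = solve-∀ ℚ-ring

  evalAt-*ι : ∀ r x q → evalAt r (x *₅ ι q) ≡ evalAt r x * q
  evalAt-*ι r (a , b) q = eq a b q r
    where eq : ∀ a b q r → a * q + 5ℚ * (b * 0ℚ) + (a * 0ℚ + b * q) * r ≡ (a + b * r) * q
          eq = solve-∀ ℚ-ring

  -- ℓ ≤ √5 ≤ u, and a + b√5 lies between a + b ℓ and a + b u.
  positive₅-bracket : ∀ {ℓ u} x → ℓ * ℓ ≤ 5ℚ → 0ℚ ≤ u → 5ℚ ≤ u * u →
                      0ℚ < evalAt ℓ x → 0ℚ < evalAt u x → Positive₅ x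
  positive₅-bracket {ℓ} {u} (a , b) ℓ²≤5 0≤u 5≤u² 0<a+bℓ 0<a+bu with <-cmp b 0ℚ
  ... | tri≈ _ refl _ = inj₁ (<⇒≤ 0<a , ≤-refl , inj₁ 0<a)
    where 0<a = subst (0ℚ <_) (evalAt-ι ℓ a) 0<a+bℓ
  ... | tri> _ _ 0<b with 0ℚ ≤? a
  ...   | yes 0≤a = inj₁ (0≤a , <⇒≤ 0<b , inj₂ 0<b)
  ...   | no  0≰a = inj₂ (inj₂ (a<0 , 0<b , 0<q-p⇒p<q (subst (0ℚ <_) (sym (eq a b ℓ)) gap)))
    where
    eq : ∀ a b ℓ → 5ℚ * (b * b) - a * a ≡
                   b * b * (5ℚ - ℓ * ℓ) + (a + b * ℓ) * ((a + b * ℓ) + 2ℚ * (- a))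
    eq = solve-∀ ℚ-ring
    a<0 = ≰⇒> 0≰a
    gap = nonNeg+pos (nonNeg*nonNeg (square-nonNeg b) (p≤q⇒0≤q-p ℓ²≤5))
               (pos*pos 0<a+bℓ (pos+nonNeg 0<a+bℓ
                 (nonNeg*nonNeg (<⇒≤ (positive⁻¹ 2ℚ)) (<⇒≤ (neg-antimono-< a<0)))))
  positive₅-bracket {ℓ} {u} (a , b) ℓ²≤5 0≤u 5≤u² 0<a+bℓ 0<a+bu | tri< b<0 _ _ =
    inj₂ (inj₁ (0<a , b<0 , 0<q-p⇒p<q (subst (0ℚ <_) (sym (eq₂ a b u)) gap)))
    where
    eq₁ : ∀ a b u → a ≡ (a + b * u) + (- b) * u
    eq₁ = solve-∀ ℚ-ring
    eq₂ : ∀ a b u → a * a - 5ℚ * (b * b) ≡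
                    b * b * (u * u - 5ℚ) + (a + b * u) * ((a + b * u) + 2ℚ * ((- b) * u))
    eq₂ = solve-∀ ℚ-ring
    0≤-bu = nonNeg*nonNeg (<⇒≤ (neg-antimono-< b<0)) 0≤u
    0<a = subst (0ℚ <_) (sym (eq₁ a b u)) (pos+nonNeg 0<a+bu 0≤-bu)
    gap = nonNeg+pos (nonNeg*nonNeg (square-nonNeg b) (p≤q⇒0≤q-p 5≤u²))
               (pos*pos 0<a+bu (pos+nonNeg 0<a+bu (nonNeg*nonNeg (<⇒≤ (positive⁻¹ 2ℚ)) 0≤-bu)))

  AbsDiffLt : ℚ → ℚ → ℚ → Set
  AbsDiffLt p q z = (p - q < z) × (q - p < z)

  AbsDiffLt-cong : ∀ {p p′ q q′ z z′} → p ≡ p′ → q ≡ q′ → z ≡ z′ →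
                   AbsDiffLt p′ q′ z′ → AbsDiffLt p q z
  AbsDiffLt-cong refl refl refl d = d

  absDiffLt₅-bracket : ∀ {ℓ u} x y z → ℓ * ℓ ≤ 5ℚ → 0ℚ ≤ u → 5ℚ ≤ u * u →
    AbsDiffLt (evalAt ℓ x) (evalAt ℓ y) (evalAt ℓ z) → AbsDiffLt (evalAt u x) (evalAt u y) (evalAt u z) →
    AbsDiffLt₅ x y z
  absDiffLt₅-bracket x y z ℓ²≤5 0≤u 5≤u² (x-y<z , y-x<z) (x-y<z′ , y-x<z′) =
    positive₅-bracket (z -₅ (x -₅ y)) ℓ²≤5 0≤u 5≤u² (margin x y x-y<z) (margin x y x-y<z′) ,
    positive₅-bracket (z -₅ (y -₅ x)) ℓ²≤5 0≤u 5≤u² (margin y x y-x<z) (margin y x y-x<z′)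
    where
    margin : ∀ {r} v w → evalAt r v - evalAt r w < evalAt r z → 0ℚ < evalAt r (z -₅ (v -₅ w))
    margin {r} v w v-w<z =
      subst (0ℚ <_) (sym (trans (evalAt-- r z (v -₅ w)) (cong (λ d → evalAt r z - d) (evalAt-- r v w))))
            (p<q⇒0<q-p v-w<z)

  asympAt : ℚ → ℚ → ℚ
  asympAt ν r = + 1 / 10 * ((5ℚ + r) * ν + r - 1ℚ)

  evalAt-asymp : ∀ n r → evalAt r (asymp n) ≡ asympAt (+ n / 1) r
  evalAt-asymp n r = begin
    evalAt r (ι (+ 1 / 10) *₅ (slope *₅ ι n̂ +₅ √5 -₅ ι 1ℚ))
      ≡⟨ evalAt-ι* r (+ 1 / 10) (slope *₅ ι n̂ +₅ √5 -₅ ι 1ℚ) ⟩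
    + 1 / 10 * evalAt r (slope *₅ ι n̂ +₅ √5 -₅ ι 1ℚ)
      ≡⟨ cong (+ 1 / 10 *_) (trans (evalAt-- r (slope *₅ ι n̂ +₅ √5) (ι 1ℚ))
                                     (cong₂ _-_ (evalAt-+ r (slope *₅ ι n̂) √5) (evalAt-ι r 1ℚ))) ⟩
    + 1 / 10 * (evalAt r (slope *₅ ι n̂) + evalAt r √5 - 1ℚ)
      ≡⟨ cong₂ (λ s t → + 1 / 10 * (s + t - 1ℚ)) (evalAt-*ι r slope n̂) (evalAt-√5 r) ⟩
    + 1 / 10 * (evalAt r slope * n̂ + r - 1ℚ)
      ≡⟨ cong (λ s → + 1 / 10 * (s * n̂ + r - 1ℚ)) (trans (evalAt-+ r (ι 5ℚ) √5)
                                                (cong₂ _+_ (evalAt-ι r 5ℚ) (evalAt-√5 r))) ⟩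
    asympAt n̂ r ∎
    where
    open ≡-Reasoning
    n̂ = + n / 1
    slope = ι 5ℚ +₅ √5

  asympAt-close : ∀ {ν ε t r} → 1ℚ ≤ ν → 0ℚ < ε → 0ℚ ≤ r → t - r ≤ ε → r - t ≤ ε →
                  AbsDiffLt (asympAt ν t) (asympAt ν r) (ε * asympAt ν r)
  asympAt-close {ν} {ε} {t} {r} 1≤ν 0<ε 0≤r t-r≤ε r-t≤ε =
    0<q-p⇒p<q (subst (0ℚ <_) (sym (below ν ε t r)) (margin (p≤q⇒0≤q-p t-r≤ε))) ,
    0<q-p⇒p<q (subst (0ℚ <_) (sym (above ν ε t r)) (margin (p≤q⇒0≤q-p r-t≤ε)))
    where
    -- asympAt is unfolded so that the ring solver sees polynomials
    below : ∀ ν ε t r → let G = λ x → + 1 / 10 * ((5ℚ + x) * ν + x - 1ℚ) in ε * G r - (G t - G r) ≡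
      + 1 / 10 * (ε * (4ℚ * (ν - 1ℚ) + 2ℚ) + ε * r * (ν - 1ℚ + 2ℚ) + (ν - 1ℚ + 2ℚ) * (ε - (t - r)))
    below = solve-∀ ℚ-ring
    above : ∀ ν ε t r → let G = λ x → + 1 / 10 * ((5ℚ + x) * ν + x - 1ℚ) in ε * G r - (G r - G t) ≡
      + 1 / 10 * (ε * (4ℚ * (ν - 1ℚ) + 2ℚ) + ε * r * (ν - 1ℚ + 2ℚ) + (ν - 1ℚ + 2ℚ) * (ε - (r - t)))
    above = solve-∀ ℚ-ring
    0≤ν-1 = p≤q⇒0≤q-p 1≤ν
    0<2 = positive⁻¹ (2ℚ)
    0≤ν+1 = nonNeg+nonNeg 0≤ν-1 (<⇒≤ 0<2)
    margin : ∀ {d} → 0ℚ ≤ ε - d →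
      0ℚ < + 1 / 10 * (ε * (4ℚ * (ν - 1ℚ) + 2ℚ) + ε * r * (ν - 1ℚ + 2ℚ) + (ν - 1ℚ + 2ℚ) * (ε - d))
    margin 0≤ε-d = pos*pos (positive⁻¹ (+ 1 / 10))
      (pos+nonNeg
        (pos+nonNeg (pos*pos 0<ε (nonNeg+pos (nonNeg*nonNeg (<⇒≤ (positive⁻¹ 4ℚ)) 0≤ν-1) 0<2))
                  (nonNeg*nonNeg (nonNeg*nonNeg (<⇒≤ 0<ε) 0≤r) 0≤ν+1))
            (nonNeg*nonNeg 0≤ν+1 0≤ε-d))

  brackets-√5 : ∀ {t e} → 1ℚ ≤ t → 0ℚ ≤ e → e ≤ 1ℚ → 5ℚ - e ≤ t * t → t * t ≤ 5ℚ + e →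
                (t - e) * (t - e) ≤ 5ℚ × 5ℚ ≤ (t + e) * (t + e)
  brackets-√5 {t} {e} 1≤t 0≤e e≤1 5-e≤t² t²≤5+e =
    0≤q-p⇒p≤q (subst (0ℚ ≤_) (sym (below t e))
      (nonNeg+nonNeg (nonNeg+nonNeg (p≤q⇒0≤q-p t²≤5+e) 0≤2e[t-1]) (nonNeg*nonNeg 0≤e (p≤q⇒0≤q-p e≤1)))) ,
    0≤q-p⇒p≤q (subst (0ℚ ≤_) (sym (above t e))
      (nonNeg+nonNeg (nonNeg+nonNeg (nonNeg+nonNeg (p≤q⇒0≤q-p 5-e≤t²) 0≤2e[t-1]) 0≤e) (square-nonNeg e)))
    where
    below : ∀ t e → 5ℚ - (t - e) * (t - e) ≡ (5ℚ + e - t * t) + 2ℚ * e * (t - 1ℚ) + e * (1ℚ - e)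
    below = solve-∀ ℚ-ring
    above : ∀ t e → (t + e) * (t + e) - 5ℚ ≡ (t * t - (5ℚ - e)) + 2ℚ * e * (t - 1ℚ) + e + e * e
    above = solve-∀ ℚ-ring
    0≤2e[t-1] = nonNeg*nonNeg (nonNeg*nonNeg (<⇒≤ (positive⁻¹ 2ℚ)) 0≤e) (p≤q⇒0≤q-p 1≤t)

  asympAt≈asymp : ∀ {ε e t} n → 1 ℕ.≤ n → 0ℚ < ε → 0ℚ < e → e ≤ 1ℚ → e ≤ ε → 1ℚ ≤ t →
                  5ℚ - e ≤ t * t → t * t ≤ 5ℚ + e →
                  AbsDiffLt₅ (ι (asympAt (+ n / 1) t)) (asymp n) (ι ε *₅ asymp n)
  asympAt≈asymp {ε} {e} {t} n 1≤n 0<ε 0<e e≤1 e≤ε 1≤t 5-e≤t² t²≤5+e =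
    absDiffLt₅-bracket (ι (asympAt (+ n / 1) t)) (asymp n) (ι ε *₅ asymp n)
      (proj₁ brackets) 0≤t+e (proj₂ brackets)
      (at (t - e) (p≤q⇒0≤q-p e≤t)
          (subst (_≤ ε) (sym (cancel₋ t e)) e≤ε) (subst (_≤ ε) (sym (flip₋ t e)) -e≤ε))
      (at (t + e) 0≤t+e
          (subst (_≤ ε) (sym (flip₊ t e)) -e≤ε) (subst (_≤ ε) (sym (cancel₊ t e)) e≤ε))
    where
    0≤e = <⇒≤ 0<e
    -e≤ε = neg≤nonNeg 0≤e (<⇒≤ 0<ε)
    e≤t = ≤-trans e≤1 1≤t
    0≤t+e = nonNeg+nonNeg (≤-trans (<⇒≤ (positive⁻¹ 1ℚ)) 1≤t) 0≤e
    brackets = brackets-√5 1≤t 0≤e e≤1 5-e≤t² t²≤5+e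
    cancel₋ : ∀ t e → t - (t - e) ≡ e
    cancel₋ = solve-∀ ℚ-ring
    cancel₊ : ∀ t e → t + e - t ≡ e
    cancel₊ = solve-∀ ℚ-ring
    flip₋ : ∀ t e → t - e - t ≡ - e
    flip₋ = solve-∀ ℚ-ring
    flip₊ : ∀ t e → t - (t + e) ≡ - e
    flip₊ = solve-∀ ℚ-ring
    at : ∀ r → 0ℚ ≤ r → t - r ≤ ε → r - t ≤ ε →
         AbsDiffLt (evalAt r (ι (asympAt (+ n / 1) t))) (evalAt r (asymp n)) (evalAt r (ι ε *₅ asymp n))
    at r 0≤r t-r≤ε r-t≤ε =
      AbsDiffLt-cong (evalAt-ι r _) (evalAt-asymp n r)
                     (trans (evalAt-ι* r ε (asymp n)) (cong (ε *_) (evalAt-asymp n r)))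
                     (asympAt-close (/1-mono-≤ 1≤n) 0<ε 0≤r t-r≤ε r-t≤ε)

  ∼asymp-criterion : ∀ (f t : ℕ → ℚ) → (∀ n → f n ≡ asympAt (+ n / 1) (t n)) → (∀ n → 1ℚ ≤ t n) →
    (∀ m → ∃ λ N → ∀ n → N ℕ.≤ n → 5ℚ - + 1 / suc m ≤ t n * t n × t n * t n ≤ 5ℚ + + 1 / suc m) →
    f ∼ asymp
  ∼asymp-criterion f t f≡asympAt 1≤t t²→5 ε 0<ε =
    let m , e≤ε = ∃unitFraction≤ ε 0<ε
        N , t²≈5 = t²→5 m
    in suc N , λ n N<n →
         subst (λ v → AbsDiffLt₅ (ι v) (asymp n) (ι ε *₅ asymp n)) (sym (f≡asympAt n))
           (asympAt≈asymp n (ℕ.≤-trans (s≤s z≤n) N<n) 0<ε (unitFraction-pos m) (unitFraction≤1 m) e≤ε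
              (1≤t n)
              (proj₁ (t²≈5 n (ℕ.<⇒≤ N<n))) (proj₂ (t²≈5 n (ℕ.<⇒≤ N<n))))

  -- Ratios of Fibonacci numbers

  -- equal to L (n + 1) / F (n + 1) for the Lucas numbers L
  lucasRatio : ℕ → ℚ
  lucasRatio n = 1ℚ + 2ℚ * ratio (F n) (F (suc n))

  ratio≡asympAt : ∀ {T n x Y} → 1 ℕ.≤ Y → 5 ℕ.* T ≡ 3 ℕ.* n ℕ.* Y ℕ.+ suc n ℕ.* x →
                  ratio T Y ≡ asympAt (+ n / 1) (1ℚ + 2ℚ * ratio x Y)
  ratio≡asympAt {T} {n} {x} {Y} 1≤Y 5T≡ = begin
    ratio T Y
      ≡⟨ ratio-split T 1≤Y ⟩
    T̂ * w
      ≡⟨ scale T̂ w ⟩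
    + 1 / 5 * (5ℚ * T̂ * w)
      ≡⟨ cong (λ v → + 1 / 5 * (v * w)) 5T̂≡ ⟩
    + 1 / 5 * ((3ℚ * n̂ * Ŷ + (1ℚ + n̂) * x̂) * w)
      ≡⟨ distribute n̂ Ŷ x̂ w ⟩
    + 1 / 5 * (3ℚ * n̂ * (Ŷ * w) + (1ℚ + n̂) * (x̂ * w))
      ≡⟨ cong (λ v → + 1 / 5 * (3ℚ * n̂ * v + (1ℚ + n̂) * (x̂ * w))) (ratio-inverse 1≤Y) ⟩
    + 1 / 5 * (3ℚ * n̂ * 1ℚ + (1ℚ + n̂) * (x̂ * w))
      ≡⟨ affine n̂ (x̂ * w) ⟩
    asympAt n̂ (1ℚ + 2ℚ * (x̂ * w))
      ≡⟨ cong (λ ρ → asympAt n̂ (1ℚ + 2ℚ * ρ)) (ratio-split x 1≤Y) ⟨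
    asympAt n̂ (1ℚ + 2ℚ * ratio x Y) ∎
    where
    open ≡-Reasoning
    n̂ = + n / 1
    T̂ = + T / 1
    x̂ = + x / 1
    Ŷ = + Y / 1
    w = ratio 1 Y
    5T̂≡ : 5ℚ * T̂ ≡ 3ℚ * n̂ * Ŷ + (1ℚ + n̂) * x̂
    5T̂≡ = begin
      5ℚ * T̂                                  ≡⟨ /1-* 5 T ⟨
      + (5 ℕ.* T) / 1                               ≡⟨ cong (λ k → + k / 1) 5T≡ ⟩
      + (3 ℕ.* n ℕ.* Y ℕ.+ suc n ℕ.* x) / 1         ≡⟨ /1-+ (3 ℕ.* n ℕ.* Y) (suc n ℕ.* x) ⟩
      + (3 ℕ.* n ℕ.* Y) / 1 + + (suc n ℕ.* x) / 1
        ≡⟨ cong₂ _+_ (trans (/1-* (3 ℕ.* n) Y) (cong (_* Ŷ) (/1-* 3 n)))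
                     (trans (/1-* (suc n) x) (cong (_* x̂) (/1-+ 1 n))) ⟩
      3ℚ * n̂ * Ŷ + (1ℚ + n̂) * x̂               ∎
    scale : ∀ a w → a * w ≡ + 1 / 5 * (5ℚ * a * w)
    scale = solve-∀ ℚ-ring
    distribute : ∀ ν Y x w → + 1 / 5 * ((3ℚ * ν * Y + (1ℚ + ν) * x) * w) ≡
                             + 1 / 5 * (3ℚ * ν * (Y * w) + (1ℚ + ν) * (x * w))
    distribute = solve-∀ ℚ-ring
    affine : ∀ ν ρ → + 1 / 5 * (3ℚ * ν * 1ℚ + (1ℚ + ν) * ρ) ≡
                     + 1 / 10 * ((5ℚ + (1ℚ + 2ℚ * ρ)) * ν + (1ℚ + 2ℚ * ρ) - 1ℚ)
    affine = solve-∀ ℚ-ring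

  expectedLucky≡asympAt : ∀ n → expectedLucky n ≡ asympAt (+ n / 1) (lucasRatio n)
  expectedLucky≡asympAt n =
    trans (expectedLucky≡ratio n)
          (ratio≡asympAt {totalParts n} {n} {F n} {F (suc n)} (F-pos n) (5*totalParts n))

  1≤lucasRatio : ∀ n → 1ℚ ≤ lucasRatio n
  1≤lucasRatio n = +-monoʳ-≤ 1ℚ (nonNeg*nonNeg (<⇒≤ (positive⁻¹ 2ℚ)) (ratio-nonNeg (F n) (F (suc n))))

  cassini⇒t²≡5∓4w² : ∀ {x Y w t} → Y * w ≡ 1ℚ → t ≡ 1ℚ + 2ℚ * (x * w) →
    (Y * Y ≡ x * Y + x * x + 1ℚ) ⊎ (Y * Y + 1ℚ ≡ x * Y + x * x) →
    (t * t + 4ℚ * (w * w) ≡ 5ℚ) ⊎ (t * t ≡ 5ℚ + 4ℚ * (w * w))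
  cassini⇒t²≡5∓4w² {x} {Y} {w} Yw≡1 refl (inj₁ Y²≡xY+x²+1) = inj₁ (begin
    (1ℚ + 2ℚ * (x * w)) * (1ℚ + 2ℚ * (x * w)) + 4ℚ * (w * w)
      ≡⟨ cong (λ o → (o + 2ℚ * (x * w)) * (o + 2ℚ * (x * w)) + 4ℚ * (w * w)) Yw≡1 ⟨
    (Y * w + 2ℚ * (x * w)) * (Y * w + 2ℚ * (x * w)) + 4ℚ * (w * w)
      ≡⟨ expand x Y w ⟩
    w * w * (Y * Y + 4ℚ * (x * Y + x * x + 1ℚ))
      ≡⟨ cong (λ s → w * w * (Y * Y + 4ℚ * s)) Y²≡xY+x²+1 ⟨
    w * w * (Y * Y + 4ℚ * (Y * Y))
      ≡⟨ collect Y w ⟩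
    5ℚ * ((Y * w) * (Y * w))
      ≡⟨ cong (λ v → 5ℚ * (v * v)) Yw≡1 ⟩
    5ℚ * (1ℚ * 1ℚ) ≡⟨⟩
    5ℚ ∎)
    where
    open ≡-Reasoning
    expand : ∀ x Y w → (Y * w + 2ℚ * (x * w)) * (Y * w + 2ℚ * (x * w)) + 4ℚ * (w * w) ≡
                       w * w * (Y * Y + 4ℚ * (x * Y + x * x + 1ℚ))
    expand = solve-∀ ℚ-ring
    collect : ∀ Y w → w * w * (Y * Y + 4ℚ * (Y * Y)) ≡ 5ℚ * ((Y * w) * (Y * w))
    collect = solve-∀ ℚ-ring
  cassini⇒t²≡5∓4w² {x} {Y} {w} Yw≡1 refl (inj₂ Y²+1≡xY+x²) = inj₂ (begin
    (1ℚ + 2ℚ * (x * w)) * (1ℚ + 2ℚ * (x * w))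
      ≡⟨ cong (λ o → (o + 2ℚ * (x * w)) * (o + 2ℚ * (x * w))) Yw≡1 ⟨
    (Y * w + 2ℚ * (x * w)) * (Y * w + 2ℚ * (x * w))
      ≡⟨ expand x Y w ⟩
    w * w * (Y * Y + 4ℚ * (x * Y + x * x))
      ≡⟨ cong (λ s → w * w * (Y * Y + 4ℚ * s)) Y²+1≡xY+x² ⟨
    w * w * (Y * Y + 4ℚ * (Y * Y + 1ℚ))
      ≡⟨ collect Y w ⟩
    5ℚ * ((Y * w) * (Y * w)) + 4ℚ * (w * w)
      ≡⟨ cong (λ v → 5ℚ * (v * v) + 4ℚ * (w * w)) Yw≡1 ⟩
    5ℚ * (1ℚ * 1ℚ) + 4ℚ * (w * w) ≡⟨⟩
    5ℚ + 4ℚ * (w * w) ∎)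
    where
    open ≡-Reasoning
    expand : ∀ x Y w → (Y * w + 2ℚ * (x * w)) * (Y * w + 2ℚ * (x * w)) ≡
                       w * w * (Y * Y + 4ℚ * (x * Y + x * x))
    expand = solve-∀ ℚ-ring
    collect : ∀ Y w → w * w * (Y * Y + 4ℚ * (Y * Y + 1ℚ)) ≡ 5ℚ * ((Y * w) * (Y * w)) + 4ℚ * (w * w)
    collect = solve-∀ ℚ-ring

  5∓δ⇒5±e : ∀ {s δ e} → 0ℚ ≤ δ → δ ≤ e → (s + δ ≡ 5ℚ) ⊎ (s ≡ 5ℚ + δ) →
           5ℚ - e ≤ s × s ≤ 5ℚ + e
  5∓δ⇒5±e {s} {δ} {e} 0≤δ δ≤e (inj₁ s+δ≡5) =
    subst (λ v → 5ℚ - e ≤ v × v ≤ 5ℚ + e) (sym s≡5-δ)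
      (+-monoʳ-≤ 5ℚ (neg-antimono-≤ δ≤e) , +-monoʳ-≤ 5ℚ (neg≤nonNeg 0≤δ (≤-trans 0≤δ δ≤e)))
    where
    subtract : ∀ s δ → s ≡ s + δ - δ
    subtract = solve-∀ ℚ-ring
    s≡5-δ = trans (subtract s δ) (cong (_- δ) s+δ≡5)
  5∓δ⇒5±e {s} {δ} {e} 0≤δ δ≤e (inj₂ refl) =
    +-monoʳ-≤ 5ℚ (neg≤nonNeg (≤-trans 0≤δ δ≤e) 0≤δ) , +-monoʳ-≤ 5ℚ δ≤e

  4[1/Y]²≤1/M : ∀ {Y M} → 1 ℕ.≤ Y → 1 ℕ.≤ M → 4 ℕ.* M ℕ.≤ Y ℕ.* Y →
                     4ℚ * (ratio 1 Y * ratio 1 Y) ≤ ratio 1 M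
  4[1/Y]²≤1/M {Y} {M} 1≤Y 1≤M 4M≤Y² = begin
    4ℚ * (w * w)                 ≡⟨ *-identityʳ _ ⟨
    4ℚ * (w * w) * 1ℚ            ≡⟨ cong (4ℚ * (w * w) *_) (ratio-inverse 1≤M) ⟨
    4ℚ * (w * w) * (M̂ * e)       ≡⟨ regroup₁ w M̂ e ⟩
    (4ℚ * M̂) * (w * w * e)       ≤⟨ *-monoʳ-≤-nonNeg (w * w * e) {{nonNegative 0≤w²e}}
                                            (subst₂ _≤_ (/1-* 4 M) (/1-* Y Y) (/1-mono-≤ 4M≤Y²)) ⟩
    (Ŷ * Ŷ) * (w * w * e)             ≡⟨ regroup₂ Ŷ w e ⟩
    (Ŷ * w) * (Ŷ * w) * e             ≡⟨ cong (λ v → v * v * e) (ratio-inverse 1≤Y) ⟩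
    1ℚ * 1ℚ * e                       ≡⟨ *-identityˡ e ⟩
    e                                 ∎
    where
    open ≤-Reasoning
    w = ratio 1 Y
    e = ratio 1 M
    Ŷ = + Y / 1
    M̂ = + M / 1
    0≤w²e = nonNeg*nonNeg (square-nonNeg w) (ratio-nonNeg 1 M)
    regroup₁ : ∀ w M e → 4ℚ * (w * w) * (M * e) ≡ (4ℚ * M) * (w * w * e)
    regroup₁ = solve-∀ ℚ-ring
    regroup₂ : ∀ Y w e → (Y * Y) * (w * w * e) ≡ (Y * w) * (Y * w) * e
    regroup₂ = solve-∀ ℚ-ring

  /1-xY+x² : ∀ x Y → + (x ℕ.* Y ℕ.+ x ℕ.* x) / 1 ≡ (+ x / 1) * (+ Y / 1) + (+ x / 1) * (+ x / 1)
  /1-xY+x² x Y = trans (/1-+ (x ℕ.* Y) (x ℕ.* x)) (cong₂ _+_ (/1-* x Y) (/1-* x x))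

  cassini-ℚ : ∀ n → let x = + F n / 1; Y = + F (suc n) / 1 in
             (Y * Y ≡ x * Y + x * x + 1ℚ) ⊎ (Y * Y + 1ℚ ≡ x * Y + x * x)
  cassini-ℚ n = ⊎.map lift₁ lift₂ (cassini n)
    where
    x = F n
    Y = F (suc n)
    lift₁ : Y ℕ.* Y ≡ x ℕ.* Y ℕ.+ x ℕ.* x ℕ.+ 1 → _
    lift₁ eq = trans (sym (/1-* Y Y)) (trans (cong (λ k → + k / 1) eq)
                 (trans (/1-+ (x ℕ.* Y ℕ.+ x ℕ.* x) 1) (cong (_+ 1ℚ) (/1-xY+x² x Y))))
    lift₂ : Y ℕ.* Y ℕ.+ 1 ≡ x ℕ.* Y ℕ.+ x ℕ.* x → _
    lift₂ eq = trans (cong (_+ 1ℚ) (sym (/1-* Y Y))) (trans (sym (/1-+ (Y ℕ.* Y) 1))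
                 (trans (cong (λ k → + k / 1) eq) (/1-xY+x² x Y)))

  lucasRatio²≈5 : ∀ m → ∃ λ N → ∀ n → N ℕ.≤ n →
    5ℚ - + 1 / suc m ≤ lucasRatio n * lucasRatio n × lucasRatio n * lucasRatio n ≤ 5ℚ + + 1 / suc m
  lucasRatio²≈5 m = 4 ℕ.* suc m , close
    where
    close : ∀ n → 4 ℕ.* suc m ℕ.≤ n →
      5ℚ - + 1 / suc m ≤ lucasRatio n * lucasRatio n × lucasRatio n * lucasRatio n ≤ 5ℚ + + 1 / suc m
    close n 4M≤n =
      5∓δ⇒5±e (nonNeg*nonNeg (<⇒≤ (positive⁻¹ 4ℚ)) (square-nonNeg (ratio 1 (F (suc n)))))
             (4[1/Y]²≤1/M (F-pos n) (s≤s z≤n) 4M≤Y²)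
             (cassini⇒t²≡5∓4w² {+ F n / 1} {+ F (suc n) / 1} (ratio-inverse (F-pos n))
                (cong (λ ρ → 1ℚ + 2ℚ * ρ) (ratio-split (F n) (F-pos n))) (cassini-ℚ n))
      where
      4M≤Y² = ℕ.≤-trans 4M≤n
                (ℕ.≤-trans (n≤F[1+n] n) (ℕ.m≤m*n (F (suc n)) (F (suc n)) {{ℕ.>-nonZero (F-pos n)}}))

  expectedLucky∼asymp : expectedLucky ∼ asymp
  expectedLucky∼asymp =
    ∼asymp-criterion expectedLucky lucasRatio expectedLucky≡asympAt 1≤lucasRatio lucasRatio²≈5

open import Defs
open import Data.Nat using (ℕ; suc; _≤_)
open import Data.Product using (_×_; _,_)
open import Relation.Binary.PropositionalEquality using (_≡_; trans; cong; sym)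
open Counting using (expectedLucky≡ratio)
open ClosedForm using (closedSum≡totalParts)
open Asymptotics using (expectedLucky∼asymp)

expectedLucky≡closedForm : ∀ n → expectedLucky n ≡ closedForm n
expectedLucky≡closedForm n =
  trans (expectedLucky≡ratio n) (cong (λ s → ratio s (F (suc n))) (sym (closedSum≡totalParts n)))

corollary3p16 : (∀ (n : ℕ) → 1 ≤ n → expectedLucky n ≡ closedForm n)
                × (expectedLucky ∼ asymp)
corollary3p16 = (λ n _ → expectedLucky≡closedForm n) , expectedLucky∼asymp
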